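{- Let $n\ge2$ and equip $\mathcal{G}^s_{n-2}$ with its standard labeling. For $\omega\in\Omega(\mathcal{G}^s_{n-2})$ let $\ell_1,\dots,\ell_{n-1}$ be the multiplicities of the vertical edges of $\mathcal{G}^s_{n-2}$ read from right to left, and let $\varphi(\omega)\in S_n$ be the permutation whose Lehmer code $(L_1,\dots,L_n)$ is given by $L_i=\sum_{j=1}^{i}(-1)^{j+1}\ell_j-\lfloor i/2\rfloor$ for $1\le i\le n-1$ and $L_n=0$. Then: (a) $\varphi$ is a poset isomorphism from $\Omega(\mathcal{G}^s_{n-2})$ with the face twist order onto the set $\mathrm{Alt}_n$ of alternating permutations with the restriction of the left middle order. (b) $\displaystyle E_n(q):=\sum_{\sigma\in\mathrm{Alt}_n}q^{\mathrm{inv}(\sigma)} = q^{\lfloor n/2\rfloor}\,\Omega(\mathcal{G}^s_{n-2},q)$.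
   Context: Mixed dimer covers: for a finite graph $\mathcal{G}=(V,E)$ and $\mathbf{n}\colon V\to\mathbb{N}$, a mixed dimer cover is $\omega\colon E\to\mathbb{N}$ with $\sum_{e\ni v}\omega(e)=\mathbf{n}(v)$ for all $v$. $\mathcal{G}^s_N$ is the $2\times(N+1)$ grid graph with vertices $v_{r,k}$ ($r=1$ bottom, $r=2$ top, $0\le k\le N$), vertical edges $v_{1,k}v_{2,k}$, horizontal edges $v_{r,k-1}v_{r,k}$. Its standard labeling gives both $v_{1,k},v_{2,k}$ the value $k+1$; $\Omega(\mathcal{G}^s_N)$ is the set of mixed dimer covers for this labeling. Face twist order: properly 2-color the vertices black/white so that the bottom-right vertex $v_{1,N}$ is black. Traversing the boundary of a square face counterclockwise, an edge traversed from black to white is even and one traversed from white to black is odd. If all odd edges of a face have positive multiplicity in $\omega$, decreasing each odd edge by $1$ and increasing each even edge by $1$ is a positive face twist; the face twist order is the partial order on $\Omega(\mathcal{G}^s_N)$ generated by $\omega<\omega'$ whenever $\omega'$ is obtained from $\omega$ by a positive face twist. $\mathrm{rk}(\omega)$ is the minimal number of face twists needed to reach $\omega$ from the minimal element, and $\Omega(\mathcal{G}^s_N,q)=\sum_\omega q^{\mathrm{rk}(\omega)}$. The Lehmer code of $\sigma\in S_n$ is $(L_1,\dots,L_n)$ with $L_i=\#\{j>i:\sigma(j)<\sigma(i)\}$; the left middle order on $S_n$ is $\sigma\le\tau$ iff $L_i(\sigma)\le L_i(\tau)$ for all $i$. $\sigma\in S_n$ is alternating if $\sigma(1)>\sigma(2)<\sigma(3)>\cdots$;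 $\mathrm{inv}(\sigma)$ is the number of inversions. -}

module Defs where

open import Data.Nat using (ℕ; zero; suc; _+_; _*_; _∸_; _^_; _≤_; _<_; _<?_; _/_; _%_)
import Data.Nat as ℕ
open import Data.Nat.Properties using (_≟_)
open import Data.Integer using (ℤ; +_; _-_)
open import Data.Fin using (Fin; toℕ; inject₁; fromℕ<)
import Data.Fin as Fin
open import Data.Fin.Properties using (all?)
open import Data.Vec using (Vec; lookup; toList)
import Data.Vec as Vec
open import Data.Nat.ListAction using (sum)
open import Data.List using (List; []; _∷_; [_]; _++_; map; filter; length; take; reverse; upTo; concatMap)
open import Data.List.Relation.Unary.All using (All)
import Data.List.Relation.Unary.All as All
open import Data.List.Relation.Unary.Unique.Propositional using (Unique)
open import Data.List.Relation.Unary.Unique.DecPropositional _≟_ using (unique?)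
open import Data.List.Relation.Binary.Pointwise using (Pointwise)
open import Data.List.Membership.Propositional using (_∈_)
open import Data.Product using (Σ; Σ-syntax; _×_; _,_)
open import Data.Unit using (⊤; tt)
open import Relation.Nullary using (¬_; Dec; yes; no; _×-dec_)
open import Relation.Unary using (Decidable)
open import Relation.Binary.PropositionalEquality using (_≡_)

-- Permutations of {1..n}, written in one-line notation as lists.
-- We use the values 0..n-1 instead of 1..n (only relative order matters
-- for Lehmer codes, inversions and alternation).

IsPerm : ℕ → List ℕ → Set
IsPerm n σ = length σ ≡ n × All (λ x → x < n) σ × Unique σ

isPerm? : ∀ n → Decidable (IsPerm n)
isPerm? n σ = (length σ ≟ n) ×-dec (All.all? (λ x → x <? n) σ ×-dec unique? σ)

lehmer : List ℕ → List ℕ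
lehmer []       = []
lehmer (x ∷ xs) = length (filter (λ y → y <? x) xs) ∷ lehmer xs

inv : List ℕ → ℕ
inv []       = 0
inv (x ∷ xs) = length (filter (λ y → y <? x) xs) + inv xs

_≤LM_ : List ℕ → List ℕ → Set
σ ≤LM τ = Pointwise _≤_ (lehmer σ) (lehmer τ)

mutual
  AltDown : List ℕ → Set
  AltDown (x ∷ y ∷ xs) = y < x × AltUp (y ∷ xs)
  AltDown _            = ⊤

  AltUp : List ℕ → Set
  AltUp (x ∷ y ∷ xs) = x < y × AltDown (y ∷ xs)
  AltUp _            = ⊤

Alternating : List ℕ → Set
Alternating = AltDown

mutual
  altDown? : Decidable AltDown
  altDown? []           = yes tt
  altDown? (x ∷ [])     = yes tt
  altDown? (x ∷ y ∷ xs) = (y <? x) ×-dec altUp? (y ∷ xs)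

  altUp? : Decidable AltUp
  altUp? []           = yes tt
  altUp? (x ∷ [])     = yes tt
  altUp? (x ∷ y ∷ xs) = (x <? y) ×-dec altDown? (y ∷ xs)

allLists : ℕ → ℕ → List (List ℕ)
allLists zero    b = [ [] ]
allLists (suc m) b = concatMap (λ x → map (x ∷_) (allLists m b)) (upTo b)

altPerms : ℕ → List (List ℕ)
altPerms n = filter (λ σ → isPerm? n σ ×-dec altDown? σ) (allLists n n)

-- The graph G^s_N: vertices v_{r,k}, r ∈ {bot (=1), top (=2)}, 0 ≤ k ≤ N.

data Row : Set where
  bot top : Row

rowIdx : Row → ℕ
rowIdx bot = 0
rowIdx top = 1

-- edges: vE k = v_{1,k} v_{2,k};  hE r k = v_{r,k} v_{r,k+1}
data Edge (N : ℕ) : Set where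
  vE : Fin (suc N) → Edge N
  hE : Row → Fin N → Edge N

record Cover (N : ℕ) : Set where
  constructor cover
  field
    vert : Vec ℕ (suc N)
    botH : Vec ℕ N
    topH : Vec ℕ N
open Cover public

mult : ∀ {N} → Cover N → Edge N → ℕ
mult ω (vE k)     = lookup (vert ω) k
mult ω (hE bot k) = lookup (botH ω) k
mult ω (hE top k) = lookup (topH ω) k

leftEdge : ∀ {N} → Row → Fin (suc N) → List (Edge N)
leftEdge r Fin.zero    = []
leftEdge r (Fin.suc j) = [ hE r j ]

rightEdge : ∀ {N} → Row → Fin (suc N) → List (Edge N)
rightEdge {N} r k with toℕ k <? N
... | yes p = [ hE r (fromℕ< p) ]
... | no _  = []

incident : ∀ {N} → Row → Fin (suc N) → List (Edge N)
incident r k = vE k ∷ leftEdge r k ++ rightEdge r k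

-- mixed dimer cover for the standard labeling n(v_{r,k}) = k+1
IsCover : ∀ {N} → Cover N → Set
IsCover {N} ω = ∀ (r : Row) (k : Fin (suc N)) → sum (map (mult ω) (incident r k)) ≡ suc (toℕ k)

isCover? : ∀ {N} → Decidable (IsCover {N})
isCover? {N} ω with all? (λ k → sum (map (mult ω) (incident bot k)) ≟ suc (toℕ k))
                  | all? (λ k → sum (map (mult ω) (incident top k)) ≟ suc (toℕ k))
... | yes b | yes t = yes λ { bot k → b k ; top k → t k }
... | no ¬b | _     = no λ c → ¬b (c bot)
... | yes _ | no ¬t = no λ c → ¬t (c top)

allVecs : (m : ℕ) → ℕ → List (Vec ℕ m)
allVecs zero    b = [ Vec.[] ]
allVecs (suc m) b = concatMap (λ x → map (x Vec.∷_) (allVecs m b)) (upTo b)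

-- Ω(G^s_N) as an explicit finite list.  Every edge multiplicity is at most
-- the label of an endpoint, hence ≤ N+1, so entries range over {0..N+1}.
coverList : (N : ℕ) → List (Cover N)
coverList N =
  filter isCover?
    (concatMap (λ v → concatMap (λ b → map (cover v b) (allVecs N (suc (suc N))))
                                 (allVecs N (suc (suc N))))
               (allVecs (suc N) (suc (suc N))))

-- Face twists.  Coloring: v_{r,k} is black iff rowIdx r + k + N is even
-- (proper 2-coloring with v_{1,N} black).

Black : ℕ → Row → ℕ → Set
Black N r k = (rowIdx r + k + N) % 2 ≡ 0

-- boundary of face f (the square with columns f, f+1; f = 0..N-1),
-- traversed counterclockwise: each entry is (edge, start vertex (r , k)).
boundary : ∀ {N} → Fin N → List (Edge N × Row × ℕ)
boundary f =
    (hE bot f       , bot , toℕ f)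
  ∷ (vE (Fin.suc f) , bot , suc (toℕ f))
  ∷ (hE top f       , top , suc (toℕ f))
  ∷ (vE (inject₁ f) , top , toℕ f)
  ∷ []

-- even edge: traversed from black to white; odd: from white to black
EvenEdge : ∀ {N} → Fin N → Edge N → Set
EvenEdge {N} f e = Σ[ r ∈ Row ] Σ[ k ∈ ℕ ] ((e , r , k) ∈ boundary f × Black N r k)

OddEdge : ∀ {N} → Fin N → Edge N → Set
OddEdge {N} f e = Σ[ r ∈ Row ] Σ[ k ∈ ℕ ] ((e , r , k) ∈ boundary f × ¬ Black N r k)

OnFace : ∀ {N} → Fin N → Edge N → Set
OnFace f e = Σ[ r ∈ Row ] Σ[ k ∈ ℕ ] ((e , r , k) ∈ boundary f)

Twist : ∀ {N} → Fin N → Cover N → Cover N → Set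
Twist f ω ω' =
    (∀ e → OddEdge f e → 1 ≤ mult ω e)
  × (∀ e → OddEdge f e → suc (mult ω' e) ≡ mult ω e)
  × (∀ e → EvenEdge f e → mult ω' e ≡ suc (mult ω e))
  × (∀ e → ¬ OnFace f e → mult ω' e ≡ mult ω e)

PosTwist : ∀ {N} → Cover N → Cover N → Set
PosTwist {N} ω ω' = Σ[ f ∈ Fin N ] Twist f ω ω'

data Steps {N : ℕ} : ℕ → Cover N → Cover N → Set where
  done : ∀ {ω} → Steps 0 ω ω
  step : ∀ {k ω ω' ω''} → PosTwist ω ω' → Steps k ω' ω'' → Steps (suc k) ω ω''

_≤F_ : ∀ {N} → Cover N → Cover N → Set
ω ≤F ω' = Σ[ k ∈ ℕ ] Steps k ω ω'

ells : ∀ {N} → Cover N → List ℕ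
ells ω = reverse (toList (vert ω))

altSum : List ℕ → ℤ
altSum []       = + 0
altSum (x ∷ xs) = + x - altSum xs

phiCode : (n : ℕ) → Cover (n ∸ 2) → List ℤ
phiCode n ω =
  map (λ i → altSum (take i (ells ω)) - + (i / 2)) (map suc (upTo (n ∸ 1))) ++ [ + 0 ]

{-# OPTIONS --safe #-}
-- Count the columns of the ladder from the right.  At column q the rung ℓ_{q+1} and the two
-- horizontal edges meeting it sum to N + 1 - q in each row, so both rows carry the same
-- horizontal multiplicities b_q; they determine the cover, and the possible b are exactly those
-- with b_{q+1} + b_q ≤ N - q.  The paper's alternating-sum formula gives the Lehmer entry
-- L_p = b_p at odd positions and L_p = N + 1 - p - b_p at even ones (positions counted from 0), and
-- the constraint on two neighbouring b's is exactly the step L₁ > L₂ ≤ L₃ > … that characterises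
-- Lehmer codes of alternating permutations; hence φ is a bijection onto Alt_n.  A positive twist at
-- face q moves b_q by one in the direction that raises L_q by one and fixes every other entry, and
-- whenever the code of ω lies below that of ω′ such a twist moves ω towards ω′.  So the twist order
-- is the componentwise order of codes, the rank is the code sum minus ⌊n/2⌋ (the code sum of the
-- minimal cover), and inv σ is the sum of the Lehmer code of σ.
module Submission where

open import Data.Empty using (⊥-elim)
open import Data.Fin as Fin using (Fin; toℕ; fromℕ<; inject₁; opposite)
open import Data.Fin.Properties
  using (toℕ-fromℕ; toℕ-fromℕ<; toℕ<n; toℕ-inject₁; toℕ-injective; opposite-prop; opposite-involutive; opposite-suc)
open import Data.List using (List; []; _∷_; _++_; [_]; map; filter; length; applyUpTo; reverse; take; upTo; concatMap)
open import Data.List.Properties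
  using ( map-∘; map-++; ∷-injectiveʳ; applyUpTo-∷ʳ; map-applyUpTo; map-upTo; filter-accept; filter-reject
        ; length-map; length-applyUpTo; unfold-reverse; length-reverse )
open import Data.List.Membership.Propositional using (_∈_)
open import Data.List.Membership.Propositional.Properties
  using (∈-map⁺; ∈-map⁻; ∈-concatMap⁺; ∈-concatMap⁻; ∈-upTo⁺; ∈-filter⁺; ∈-filter⁻)
open import Data.List.Membership.Propositional.Properties.WithK using (unique∧set⇒bag)
open import Data.List.Relation.Binary.BagAndSetEquality using (∼bag⇒↭)
open import Data.List.Relation.Binary.Permutation.Propositional using (_↭_)
import Data.List.Relation.Binary.Permutation.Propositional.Properties as Perm
open import Data.List.Relation.Binary.Pointwise using (Pointwise; []; _∷_)
open import Data.List.Relation.Unary.All as All using (All; []; _∷_)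
import Data.List.Relation.Unary.All.Properties as All
open import Data.List.Relation.Unary.AllPairs using ([]; _∷_)
open import Data.List.Relation.Unary.Any as Any using (here; there)
open import Data.List.Relation.Unary.Unique.Propositional using (Unique)
import Data.List.Relation.Unary.Unique.Propositional.Properties as Unique
open import Data.Nat
  using ( ℕ; zero; suc; pred; _+_; _*_; _^_; _∸_; _/_; _%_; ⌊_/2⌋; ⌈_/2⌉
        ; _≤_; _<_; _≮_; _<?_; _≤?_; z≤n; s≤s; ≢-nonZero; parity )
open import Data.Nat.DivMod using (m/n≡1+[m∸n]/n)
open import Data.Nat.ListAction using (sum)
open import Data.Nat.ListAction.Properties using (sum-++; sum-↭)
open import Data.Nat.Properties
open import Data.Nat.Tactic.RingSolver renaming (solve-∀ to ℕ-solve-∀)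
open import Data.Parity.Base as ℙ using (Parity; 0ℙ; 1ℙ; _⁻¹)
import Data.Parity.Properties as ℙ
open import Data.Product using (Σ-syntax; _×_; _,_; proj₁; proj₂)
open import Data.Product.Function.NonDependent.Propositional using (_×-⇔_)
open import Data.Sum using (_⊎_; inj₁; inj₂; [_,_]′)
open import Data.Unit using (⊤; tt)
open import Data.Vec as Vec using (Vec; lookup; toList; tabulate)
import Data.Vec.Properties as Vec
open import Data.Vec.Properties using (length-toList; lookup∘tabulate; tabulate∘lookup; tabulate-cong)
open import Function using (id; _∘_)
open import Function.Bundles using (_⇔_; mk⇔; Equivalence)
open import Function.Construct.Composition using (_⇔-∘_)
open import Function.Construct.Symmetry using (⇔-sym)
open import Relation.Nullary using (¬_; yes; no; _×-dec_)
open import Relation.Binary.PropositionalEquality hiding ([_])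

open import Defs

open Equivalence using (to; from)

∸-suc : ∀ {m n} → n < m → m ∸ n ≡ suc (m ∸ suc n)
∸-suc {suc m} {n} (s≤s n≤m) = +-∸-assoc 1 n≤m

0ℙ-or-1ℙ : ∀ π → π ≡ 0ℙ ⊎ π ≡ 1ℙ
0ℙ-or-1ℙ 0ℙ = inj₁ refl
0ℙ-or-1ℙ 1ℙ = inj₂ refl

+-⁻¹-comm : ∀ π ρ → π ⁻¹ ℙ.+ ρ ≡ π ℙ.+ ρ ⁻¹
+-⁻¹-comm 0ℙ 0ℙ = refl
+-⁻¹-comm 0ℙ 1ℙ = refl
+-⁻¹-comm 1ℙ 0ℙ = refl
+-⁻¹-comm 1ℙ 1ℙ = refl

parity-suc : ∀ n → parity (suc n) ≡ parity n ⁻¹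
parity-suc zero          = refl
parity-suc (suc zero)    = refl
parity-suc (suc (suc n)) = parity-suc n

parity-double : ∀ t x → parity (t + (t + x)) ≡ parity x
parity-double zero    x = refl
parity-double (suc t) x = trans (cong (parity ∘ suc) (+-suc t (t + x))) (parity-double t x)

%2≡0⇔parity≡0ℙ : ∀ x → x % 2 ≡ 0 ⇔ parity x ≡ 0ℙ
%2≡0⇔parity≡0ℙ zero          = mk⇔ (λ _ → refl) (λ _ → refl)
%2≡0⇔parity≡0ℙ (suc zero)    = mk⇔ (λ ()) (λ ())
%2≡0⇔parity≡0ℙ (suc (suc x)) = %2≡0⇔parity≡0ℙ x

evenBit : Parity → ℕ
evenBit 0ℙ = 1
evenBit 1ℙ = 0

⌊2+p/2⌋ : ∀ p → ⌊ suc (suc p) /2⌋ ≡ ⌊ suc p /2⌋ + evenBit (parity p)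
⌊2+p/2⌋ zero          = refl
⌊2+p/2⌋ (suc zero)    = refl
⌊2+p/2⌋ (suc (suc p)) = cong suc (⌊2+p/2⌋ p)

⌊n/2⌋≡n/2 : ∀ m → ⌊ m /2⌋ ≡ m / 2
⌊n/2⌋≡n/2 zero          = refl
⌊n/2⌋≡n/2 (suc zero)    = refl
⌊n/2⌋≡n/2 (suc (suc m)) = trans (cong suc (⌊n/2⌋≡n/2 m)) (sym (m/n≡1+[m∸n]/n {suc (suc m)} {2} (s≤s (s≤s z≤n))))

-- Total indexing: positions past the end read as 0.
at : List ℕ → ℕ → ℕ
at []       _       = 0
at (x ∷ xs) zero    = x
at (x ∷ xs) (suc i) = at xs i

at-beyond : ∀ xs {i} → length xs ≤ i → at xs i ≡ 0
at-beyond []       _         = refl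
at-beyond (x ∷ xs) (s≤s len≤i) = at-beyond xs len≤i

at-++ˡ : ∀ xs ys {i} → i < length xs → at (xs ++ ys) i ≡ at xs i
at-++ˡ (x ∷ xs) ys {zero}  _         = refl
at-++ˡ (x ∷ xs) ys {suc i} (s≤s i<) = at-++ˡ xs ys i<

at-++-length : ∀ xs y → at (xs ++ [ y ]) (length xs) ≡ y
at-++-length []       y = refl
at-++-length (x ∷ xs) y = at-++-length xs y

at-reverse : ∀ xs {i} → i < length xs → at (reverse xs) i ≡ at xs (length xs ∸ suc i)
at-reverse (x ∷ xs) {i} i<len rewrite unfold-reverse x xs with i <? length xs
... | yes i<xs = begin
  at (reverse xs ++ [ x ]) i        ≡⟨ at-++ˡ (reverse xs) [ x ] (subst (i <_) (sym (length-reverse xs)) i<xs) ⟩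
  at (reverse xs) i                 ≡⟨ at-reverse xs i<xs ⟩
  at xs (length xs ∸ suc i)         ≡⟨ cong (at (x ∷ xs)) (∸-suc i<xs) ⟨
  at (x ∷ xs) (length xs ∸ i)       ∎
  where open ≡-Reasoning
... | no i≮xs with ≤-antisym (≤-pred i<len) (≮⇒≥ i≮xs)
... | refl = begin
  at (reverse xs ++ [ x ]) (length xs)            ≡⟨ cong (at (reverse xs ++ [ x ])) (length-reverse xs) ⟨
  at (reverse xs ++ [ x ]) (length (reverse xs))  ≡⟨ at-++-length (reverse xs) x ⟩
  x                                               ≡⟨ cong (at (x ∷ xs)) (n∸n≡0 (length xs)) ⟨
  at (x ∷ xs) (length xs ∸ length xs)             ∎
  where open ≡-Reasoning

at-applyUpTo : ∀ (f : ℕ → ℕ) {m i} → i < m → at (applyUpTo f m) i ≡ f i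
at-applyUpTo f {suc m} {zero}  _        = refl
at-applyUpTo f {suc m} {suc i} (s≤s i<m) = at-applyUpTo (f ∘ suc) i<m

applyUpTo-at : ∀ xs → applyUpTo (at xs) (length xs) ≡ xs
applyUpTo-at []       = refl
applyUpTo-at (x ∷ xs) = cong (x ∷_) (applyUpTo-at xs)

applyUpTo-cong : ∀ {A : Set} {f g : ℕ → A} m → (∀ {i} → i < m → f i ≡ g i) → applyUpTo f m ≡ applyUpTo g m
applyUpTo-cong zero    f≡g = refl
applyUpTo-cong (suc m) f≡g = cong₂ _∷_ (f≡g (s≤s z≤n)) (applyUpTo-cong m (f≡g ∘ s≤s))

applyUpTo-injective : ∀ {f g : ℕ → ℕ} m → applyUpTo f m ≡ applyUpTo g m → ∀ {i} → i < m → f i ≡ g i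
applyUpTo-injective {f} {g} m eq {i} i<m = begin
  f i                  ≡⟨ at-applyUpTo f i<m ⟨
  at (applyUpTo f m) i ≡⟨ cong (λ xs → at xs i) eq ⟩
  at (applyUpTo g m) i ≡⟨ at-applyUpTo g i<m ⟩
  g i                  ∎
  where open ≡-Reasoning

pointwise-applyUpTo : ∀ {f g : ℕ → ℕ} m →
  Pointwise _≤_ (applyUpTo f m) (applyUpTo g m) ⇔ (∀ {i} → i < m → f i ≤ g i)
pointwise-applyUpTo m = mk⇔ (to′ m) (from′ m)
  where
  to′ : ∀ {f g} m → Pointwise _≤_ (applyUpTo f m) (applyUpTo g m) → ∀ {i} → i < m → f i ≤ g i
  to′ (suc m) (f0≤g0 ∷ _)   {zero}  _         = f0≤g0
  to′ (suc m) (_     ∷ rest) {suc i} (s≤s i<m) = to′ m rest i<m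
  from′ : ∀ {f g} m → (∀ {i} → i < m → f i ≤ g i) → Pointwise _≤_ (applyUpTo f m) (applyUpTo g m)
  from′ zero    f≤g = []
  from′ (suc m) f≤g = f≤g (s≤s z≤n) ∷ from′ m (f≤g ∘ s≤s)

sum-applyUpTo-mono : ∀ {f g : ℕ → ℕ} m → (∀ {i} → i < m → f i ≤ g i) →
                     sum (applyUpTo f m) ≤ sum (applyUpTo g m)
sum-applyUpTo-mono zero    f≤g = z≤n
sum-applyUpTo-mono (suc m) f≤g = +-mono-≤ (f≤g (s≤s z≤n)) (sum-applyUpTo-mono m (f≤g ∘ s≤s))

sum-applyUpTo-increment : ∀ {f g : ℕ → ℕ} m {p} → p < m → g p ≡ suc (f p) → (∀ {i} → i ≢ p → g i ≡ f i) →
                          sum (applyUpTo g m) ≡ suc (sum (applyUpTo f m))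
sum-applyUpTo-increment {f} {g} (suc m) {zero} _ gp≡ g≡f =
  cong₂ _+_ gp≡ (cong sum (applyUpTo-cong m (λ _ → g≡f λ ())))
sum-applyUpTo-increment {f} {g} (suc m) {suc p} (s≤s p<m) gp≡ g≡f = begin
  g 0 + sum (applyUpTo (g ∘ suc) m)
    ≡⟨ cong₂ _+_ (g≡f λ ()) (sum-applyUpTo-increment m p<m gp≡ (g≡f ∘ (_∘ suc-injective))) ⟩
  f 0 + suc (sum (applyUpTo (f ∘ suc) m))
    ≡⟨ +-suc (f 0) _ ⟩
  suc (f 0 + sum (applyUpTo (f ∘ suc) m)) ∎
  where open ≡-Reasoning

sum-applyUpTo-≤-≡ : ∀ {f g : ℕ → ℕ} m → (∀ {i} → i < m → f i ≤ g i) →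
                    sum (applyUpTo f m) ≡ sum (applyUpTo g m) → ∀ {i} → i < m → f i ≡ g i
sum-applyUpTo-≤-≡ {f} {g} (suc m) f≤g sum≡ {i} i<m with m≤n⇒m<n∨m≡n (f≤g (s≤s z≤n))
... | inj₁ f0<g0 = ⊥-elim (<-irrefl sum≡ (+-mono-<-≤ f0<g0 (sum-applyUpTo-mono m (f≤g ∘ s≤s))))
... | inj₂ f0≡g0 with i | i<m
...   | zero  | _         = f0≡g0
...   | suc i | s≤s i<m′ =
  sum-applyUpTo-≤-≡ m (f≤g ∘ s≤s) (+-cancelˡ-≡ (f 0) _ _ (trans sum≡ (cong (_+ _) (sym f0≡g0)))) i<m′

sum-map-cong : ∀ {A : Set} {f g : A → ℕ} {xs} → All (λ x → f x ≡ g x) xs → sum (map f xs) ≡ sum (map g xs)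
sum-map-cong []         = refl
sum-map-cong (eq ∷ eqs) = cong₂ _+_ eq (sum-map-cong eqs)

sum-map-*ˡ : ∀ {A : Set} c (f : A → ℕ) xs → sum (map (λ x → c * f x) xs) ≡ c * sum (map f xs)
sum-map-*ˡ c f []       = sym (*-zeroʳ c)
sum-map-*ˡ c f (x ∷ xs) = trans (cong (c * f x +_) (sum-map-*ˡ c f xs)) (sym (*-distribˡ-+ c (f x) _))

sum-evenBits : ∀ m → sum (applyUpTo (evenBit ∘ parity) m) ≡ ⌈ m /2⌉
sum-evenBits zero          = refl
sum-evenBits (suc zero)    = refl
sum-evenBits (suc (suc m)) = cong suc (sum-evenBits m)

unique-map⁺ : ∀ {A B : Set} (P : A → Set) (f : A → B) → (∀ {a b} → P a → P b → f a ≡ f b → a ≡ b) →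
              ∀ {xs} → All P xs → Unique xs → Unique (map f xs)
unique-map⁺ P f f-injective []         []           = []
unique-map⁺ P f f-injective (px ∷ pxs) (x∉xs ∷ uniq) =
  All.map⁺ (All.zipWith (λ (x≢y , py) fx≡fy → x≢y (f-injective px py fx≡fy)) (x∉xs , pxs))
  ∷ unique-map⁺ P f f-injective pxs uniq

unique-concatMap : ∀ {A B : Set} (f : A → List B) (key : B → A) → (∀ {x y} → y ∈ f x → key y ≡ x) →
                   ∀ {xs} → Unique xs → (∀ x → Unique (f x)) → Unique (concatMap f xs)
unique-concatMap f key key-f []              _      = []
unique-concatMap f key key-f (x∉xs ∷ unique) unique-f =
  Unique.++⁺ (unique-f _) (unique-concatMap f key key-f unique unique-f)
    λ (v∈fx , v∈rest) → All.All¬⇒¬Any x∉xs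
                           (Any.map (λ v∈fy → trans (sym (key-f v∈fx)) (key-f v∈fy)) (∈-concatMap⁻ f v∈rest))

countBelow : ℕ → List ℕ → ℕ
countBelow x ys = length (filter (_<? x) ys)

countBelow-accept : ∀ {x y} ys → y < x → countBelow x (y ∷ ys) ≡ suc (countBelow x ys)
countBelow-accept {x} ys y<x = cong length (filter-accept (_<? x) y<x)

countBelow-reject : ∀ {x y} ys → y ≮ x → countBelow x (y ∷ ys) ≡ countBelow x ys
countBelow-reject {x} ys y≮x = cong length (filter-reject (_<? x) y≮x)

countBelow-map : ∀ (f : ℕ → ℕ) {x x′} ys → All (λ y → f y < x ⇔ y < x′) ys →
                 countBelow x (map f ys) ≡ countBelow x′ ys
countBelow-map f []       []              = refl
countBelow-map f {x} {x′} (y ∷ ys) (fy<x⇔y<x′ ∷ rest) with f y <? x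
... | yes fy<x = begin
  countBelow x (f y ∷ map f ys) ≡⟨ countBelow-accept (map f ys) fy<x ⟩
  suc (countBelow x (map f ys)) ≡⟨ cong suc (countBelow-map f ys rest) ⟩
  suc (countBelow x′ ys)        ≡⟨ countBelow-accept ys (to fy<x⇔y<x′ fy<x) ⟨
  countBelow x′ (y ∷ ys)        ∎
  where open ≡-Reasoning
... | no fy≮x = begin
  countBelow x (f y ∷ map f ys) ≡⟨ countBelow-reject (map f ys) fy≮x ⟩
  countBelow x (map f ys)       ≡⟨ countBelow-map f ys rest ⟩
  countBelow x′ ys              ≡⟨ countBelow-reject ys (fy≮x ∘ from fy<x⇔y<x′) ⟨
  countBelow x′ (y ∷ ys)        ∎
  where open ≡-Reasoning

lehmer-map : ∀ (P : ℕ → Set) (f : ℕ → ℕ) → (∀ {a b} → P a → P b → f a < f b ⇔ a < b) →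
             ∀ {xs} → All P xs → lehmer (map f xs) ≡ lehmer xs
lehmer-map P f f-embedding []         = refl
lehmer-map P f f-embedding (px ∷ pxs) =
  cong₂ _∷_ (countBelow-map f _ (All.map (λ py → f-embedding py px) pxs)) (lehmer-map P f f-embedding pxs)

length-lehmer : ∀ xs → length (lehmer xs) ≡ length xs
length-lehmer []       = refl
length-lehmer (x ∷ xs) = cong suc (length-lehmer xs)

inv≡sum∘lehmer : ∀ σ → inv σ ≡ sum (lehmer σ)
inv≡sum∘lehmer []       = refl
inv≡sum∘lehmer (x ∷ xs) = cong (countBelow x xs +_) (inv≡sum∘lehmer xs)

-- ℕ versions of Data.Fin.punchIn and Data.Fin.punchOut.
punchIn : ℕ → ℕ → ℕ
punchIn zero    y       = suc y
punchIn (suc i) zero    = zero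
punchIn (suc i) (suc y) = suc (punchIn i y)

punchOut : ℕ → ℕ → ℕ
punchOut zero    zero    = zero
punchOut zero    (suc y) = y
punchOut (suc i) zero    = zero
punchOut (suc i) (suc y) = suc (punchOut i y)

punchIn-< : ∀ i {y} → y < i → punchIn i y ≡ y
punchIn-< (suc i) {zero}  _         = refl
punchIn-< (suc i) {suc y} (s≤s y<i) = cong suc (punchIn-< i y<i)

punchIn-≥ : ∀ i {y} → i ≤ y → punchIn i y ≡ suc y
punchIn-≥ zero    _         = refl
punchIn-≥ (suc i) (s≤s i≤y) = cong suc (punchIn-≥ i i≤y)

punchIn-≤ : ∀ i y → punchIn i y ≤ suc y
punchIn-≤ zero    y       = ≤-refl
punchIn-≤ (suc i) zero    = z≤n
punchIn-≤ (suc i) (suc y) = s≤s (punchIn-≤ i y)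

punchInᵢ≢i : ∀ i y → punchIn i y ≢ i
punchInᵢ≢i (suc i) (suc y) eq = punchInᵢ≢i i y (suc-injective eq)

punchIn-injective : ∀ i {y z} → punchIn i y ≡ punchIn i z → y ≡ z
punchIn-injective zero    refl = refl
punchIn-injective (suc i) {zero}  {zero}  _  = refl
punchIn-injective (suc i) {suc y} {suc z} eq = cong suc (punchIn-injective i (suc-injective eq))

punchIn-mono-< : ∀ i {y z} → punchIn i y < punchIn i z ⇔ y < z
punchIn-mono-< i = mk⇔ (cancel i) (mono i)
  where
  mono : ∀ i {y z} → y < z → punchIn i y < punchIn i z
  mono zero    y<z               = s≤s y<z
  mono (suc i) {zero}  {suc z} _ = s≤s z≤n
  mono (suc i) {suc y} {suc z} (s≤s y<z) = s≤s (mono i y<z)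
  cancel : ∀ i {y z} → punchIn i y < punchIn i z → y < z
  cancel zero    (s≤s y<z)             = y<z
  cancel (suc i) {zero}  {suc z} _     = s≤s z≤n
  cancel (suc i) {suc y} {suc z} (s≤s lt) = s≤s (cancel i lt)

punchIn-<-below : ∀ i {x} y → x ≤ i → punchIn i y < x ⇔ y < x
punchIn-<-below i y x≤i with y <? i
... | yes y<i rewrite punchIn-< i y<i = mk⇔ (λ lt → lt) (λ lt → lt)
... | no  y≮i rewrite punchIn-≥ i (≮⇒≥ y≮i) =
  mk⇔ (λ sy<x → ⊥-elim (y≮i (<-≤-trans (<-trans (n<1+n y) sy<x) x≤i)))
      (λ y<x → ⊥-elim (y≮i (<-≤-trans y<x x≤i)))

punchIn-<-above : ∀ i {x} y → i ≤ x → punchIn i y < suc x ⇔ y < x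
punchIn-<-above i y i≤x with y <? i
... | yes y<i rewrite punchIn-< i y<i = mk⇔ (λ _ → <-≤-trans y<i i≤x) m<n⇒m<1+n
... | no  y≮i rewrite punchIn-≥ i (≮⇒≥ y≮i) = mk⇔ ≤-pred s≤s

punchIn-self : ∀ i y → i < punchIn i y ⇔ i ≤ y
punchIn-self i y with y <? i
... | yes y<i rewrite punchIn-< i y<i = mk⇔ (λ i<y → ⊥-elim (<-asym y<i i<y)) (λ i≤y → ⊥-elim (<⇒≱ y<i i≤y))
... | no  y≮i rewrite punchIn-≥ i (≮⇒≥ y≮i) = mk⇔ (λ _ → ≮⇒≥ y≮i) s≤s

punchIn-punchOut : ∀ {i y} → i ≢ y → punchIn i (punchOut i y) ≡ y
punchIn-punchOut {zero}  {zero}  0≢0 = ⊥-elim (0≢0 refl)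
punchIn-punchOut {zero}  {suc y} _   = refl
punchIn-punchOut {suc i} {zero}  _   = refl
punchIn-punchOut {suc i} {suc y} i≢y = cong suc (punchIn-punchOut (i≢y ∘ cong suc))

punchOut-mono-< : ∀ {x a b} → x ≢ a → x ≢ b → punchOut x a < punchOut x b ⇔ a < b
punchOut-mono-< {x} x≢a x≢b =
  ⇔-sym (subst₂ (λ a b → a < b ⇔ punchOut x _ < punchOut x _) (punchIn-punchOut x≢a) (punchIn-punchOut x≢b)
                (punchIn-mono-< x))

punchOut-<-self : ∀ {x y} → x ≢ y → punchOut x y < x ⇔ y < x
punchOut-<-self {x} {y} x≢y =
  ⇔-sym (subst (λ z → z < x ⇔ punchOut x y < x) (punchIn-punchOut x≢y) (punchIn-<-below x (punchOut x y) ≤-refl))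

map-punchIn-punchOut : ∀ {x} ys → All (x ≢_) ys → map (punchIn x) (map (punchOut x) ys) ≡ ys
map-punchIn-punchOut []       []           = refl
map-punchIn-punchOut (y ∷ ys) (x≢y ∷ x≢ys) = cong₂ _∷_ (punchIn-punchOut x≢y) (map-punchIn-punchOut ys x≢ys)

punchOut-isPerm : ∀ {m x xs} → IsPerm (suc m) (x ∷ xs) → IsPerm m (map (punchOut x) xs)
punchOut-isPerm {m} {x} {xs} (len , x<1+m ∷ xs<1+m , x∉xs ∷ unique) =
  trans (length-map (punchOut x) xs) (suc-injective len) ,
  All.map⁺ (All.zipWith (λ (y<1+m , x≢y) → bounded y<1+m x≢y) (xs<1+m , x∉xs)) ,
  unique-map⁺ (x ≢_) (punchOut x) injective x∉xs unique
  where
  bounded : ∀ {y} → y < suc m → x ≢ y → punchOut x y < m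
  bounded y<1+m x≢y =
    to (punchIn-<-above x (punchOut x _) (≤-pred x<1+m)) (subst (_< suc m) (sym (punchIn-punchOut x≢y)) y<1+m)
  injective : ∀ {a b} → x ≢ a → x ≢ b → punchOut x a ≡ punchOut x b → a ≡ b
  injective x≢a x≢b eq = trans (sym (punchIn-punchOut x≢a)) (trans (cong (punchIn x) eq) (punchIn-punchOut x≢b))

IsLehmerCode : List ℕ → Set
IsLehmerCode []      = ⊤
IsLehmerCode (l ∷ L) = l ≤ length L × IsLehmerCode L

-- The first entry of a permutation of {0,…,m} is its own Lehmer entry, and punching it out
-- of the remaining entries leaves a permutation of {0,…,m-1}; fromLehmer undoes this.
fromLehmer : List ℕ → List ℕ
fromLehmer []      = []
fromLehmer (l ∷ L) = l ∷ map (punchIn l) (fromLehmer L)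

length-fromLehmer : ∀ L → length (fromLehmer L) ≡ length L
length-fromLehmer []      = refl
length-fromLehmer (l ∷ L) = cong suc (trans (length-map (punchIn l) (fromLehmer L)) (length-fromLehmer L))

countBelow-fromLehmer : ∀ L → IsLehmerCode L → ∀ {x} → x ≤ length L → countBelow x (fromLehmer L) ≡ x
countBelow-fromLehmer []      _            z≤n = refl
countBelow-fromLehmer (l ∷ L) (l≤ , valid) {x} x≤ with l <? x
... | no l≮x = begin
  countBelow x (l ∷ map (punchIn l) (fromLehmer L))
    ≡⟨ countBelow-reject _ l≮x ⟩
  countBelow x (map (punchIn l) (fromLehmer L))
    ≡⟨ countBelow-map (punchIn l) (fromLehmer L) (All.universal (λ y → punchIn-<-below l y (≮⇒≥ l≮x)) _) ⟩
  countBelow x (fromLehmer L)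
    ≡⟨ countBelow-fromLehmer L valid (≤-trans (≮⇒≥ l≮x) l≤) ⟩
  x ∎
  where open ≡-Reasoning
countBelow-fromLehmer (l ∷ L) (l≤ , valid) {suc x} x≤ | yes l<x = begin
  countBelow (suc x) (l ∷ map (punchIn l) (fromLehmer L))
    ≡⟨ countBelow-accept _ l<x ⟩
  suc (countBelow (suc x) (map (punchIn l) (fromLehmer L)))
    ≡⟨ cong suc (countBelow-map (punchIn l) (fromLehmer L) (All.universal (λ y → punchIn-<-above l y (≤-pred l<x)) _)) ⟩
  suc (countBelow x (fromLehmer L))
    ≡⟨ cong suc (countBelow-fromLehmer L valid (≤-pred x≤)) ⟩
  suc x ∎
  where open ≡-Reasoning

lehmer-fromLehmer : ∀ L → IsLehmerCode L → lehmer (fromLehmer L) ≡ L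
lehmer-fromLehmer []      _            = refl
lehmer-fromLehmer (l ∷ L) (l≤ , valid) = cong₂ _∷_ head≡ tail≡
  where
  head≡ : countBelow l (map (punchIn l) (fromLehmer L)) ≡ l
  head≡ = trans (countBelow-map (punchIn l) (fromLehmer L) (All.universal (λ y → punchIn-<-below l y ≤-refl) _))
                (countBelow-fromLehmer L valid l≤)
  tail≡ : lehmer (map (punchIn l) (fromLehmer L)) ≡ L
  tail≡ = trans (lehmer-map (λ _ → ⊤) (punchIn l) (λ _ _ → punchIn-mono-< l) (All.universal _ _))
                (lehmer-fromLehmer L valid)

fromLehmer-isPerm : ∀ L → IsLehmerCode L → IsPerm (length L) (fromLehmer L)
fromLehmer-isPerm L valid = length-fromLehmer L , bounded L valid , unique L
  where
  bounded : ∀ L → IsLehmerCode L → All (_< length L) (fromLehmer L)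
  bounded []      _            = []
  bounded (l ∷ L) (l≤ , valid) =
    s≤s l≤ ∷ All.map⁺ (All.map (λ {y} y< → <-≤-trans (s≤s (punchIn-≤ l y)) (s≤s y<)) (bounded L valid))
  unique : ∀ L → Unique (fromLehmer L)
  unique []      = []
  unique (l ∷ L) = All.map⁺ (All.universal (λ y → punchInᵢ≢i l y ∘ sym) _) ∷ Unique.map⁺ (punchIn-injective l) (unique L)

fromLehmer-lehmer : ∀ m σ → IsPerm m σ → IsLehmerCode (lehmer σ) × fromLehmer (lehmer σ) ≡ σ
fromLehmer-lehmer zero    []       _ = tt , refl
fromLehmer-lehmer (suc m) (x ∷ xs) isPerm@(len , x<1+m ∷ _ , x∉xs ∷ _) =
  ( subst₂ _≤_ (sym head≡) (sym (trans (length-lehmer xs) (suc-injective len))) (≤-pred x<1+m)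
  , subst IsLehmerCode tail≡ valid′ ) ,
  cong₂ _∷_ head≡ (begin
    map (punchIn (countBelow x xs)) (fromLehmer (lehmer xs))
      ≡⟨ cong₂ (λ c L → map (punchIn c) (fromLehmer L)) head≡ (sym tail≡) ⟩
    map (punchIn x) (fromLehmer (lehmer xs′))
      ≡⟨ cong (map (punchIn x)) xs′≡ ⟩
    map (punchIn x) xs′
      ≡⟨ map-punchIn-punchOut xs x∉xs ⟩
    xs ∎)
  where
  open ≡-Reasoning
  xs′ = map (punchOut x) xs
  xs′-isPerm = punchOut-isPerm isPerm
  ih = fromLehmer-lehmer m xs′ xs′-isPerm
  valid′ = proj₁ ih
  xs′≡ = proj₂ ih
  tail≡ : lehmer xs′ ≡ lehmer xs
  tail≡ = lehmer-map (x ≢_) (punchOut x) punchOut-mono-< x∉xs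
  head≡ : countBelow x xs ≡ x
  head≡ = begin
    countBelow x xs                        ≡⟨ countBelow-map (punchOut x) xs (All.map punchOut-<-self x∉xs) ⟨
    countBelow x xs′                       ≡⟨ cong (countBelow x) xs′≡ ⟨
    countBelow x (fromLehmer (lehmer xs′)) ≡⟨ countBelow-fromLehmer (lehmer xs′) valid′
                                                (subst (x ≤_) (sym (trans (length-lehmer xs′) (proj₁ xs′-isPerm))) (≤-pred x<1+m)) ⟩
    x                                      ∎

IsLehmerCode-applyUpTo : ∀ (f : ℕ → ℕ) m → IsLehmerCode (applyUpTo f m) ⇔ (∀ {i} → i < m → f i ≤ m ∸ suc i)
IsLehmerCode-applyUpTo f m = mk⇔ (to′ f m) (from′ f m)
  where
  to′ : ∀ f m → IsLehmerCode (applyUpTo f m) → ∀ {i} → i < m → f i ≤ m ∸ suc i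
  to′ f (suc m) (f0≤ , _)    {zero}  _         = subst (f 0 ≤_) (length-applyUpTo (f ∘ suc) m) f0≤
  to′ f (suc m) (_   , rest) {suc i} (s≤s i<m) = to′ (f ∘ suc) m rest i<m
  from′ : ∀ f m → (∀ {i} → i < m → f i ≤ m ∸ suc i) → IsLehmerCode (applyUpTo f m)
  from′ f zero    _      = tt
  from′ f (suc m) bounds =
    subst (f 0 ≤_) (sym (length-applyUpTo (f ∘ suc) m)) (bounds (s≤s z≤n)) , from′ (f ∘ suc) m (bounds ∘ s≤s)

CodeStep : Parity → ℕ → ℕ → Set
CodeStep 0ℙ l l′ = l′ < l
CodeStep 1ℙ l l′ = l ≤ l′

-- ZigZag 0ℙ is the shape L₁ > L₂ ≤ L₃ > L₄ ≤ … of the Lehmer code of an alternating permutation.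
ZigZag : Parity → List ℕ → Set
ZigZag π (l ∷ l′ ∷ L) = CodeStep π l l′ × ZigZag (π ⁻¹) (l′ ∷ L)
ZigZag π _            = ⊤

module _ (f : ℕ → ℕ) (f-embedding : ∀ {a b} → f a < f b ⇔ a < b) where
  mutual
    AltDown-map : ∀ xs → AltDown (map f xs) ⇔ AltDown xs
    AltDown-map []           = mk⇔ _ _
    AltDown-map (x ∷ [])     = mk⇔ _ _
    AltDown-map (x ∷ y ∷ xs) = f-embedding ×-⇔ AltUp-map (y ∷ xs)

    AltUp-map : ∀ xs → AltUp (map f xs) ⇔ AltUp xs
    AltUp-map []           = mk⇔ _ _
    AltUp-map (x ∷ [])     = mk⇔ _ _
    AltUp-map (x ∷ y ∷ xs) = f-embedding ×-⇔ AltDown-map (y ∷ xs)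

mutual
  AltDown-fromLehmer : ∀ L → AltDown (fromLehmer L) ⇔ ZigZag 0ℙ L
  AltDown-fromLehmer []           = mk⇔ _ _
  AltDown-fromLehmer (l ∷ [])     = mk⇔ _ _
  AltDown-fromLehmer (l ∷ l′ ∷ L) =
    punchIn-<-below l l′ ≤-refl
      ×-⇔ (AltUp-fromLehmer (l′ ∷ L) ⇔-∘ AltUp-map (punchIn l) (punchIn-mono-< l) (fromLehmer (l′ ∷ L)))

  AltUp-fromLehmer : ∀ L → AltUp (fromLehmer L) ⇔ ZigZag 1ℙ L
  AltUp-fromLehmer []           = mk⇔ _ _
  AltUp-fromLehmer (l ∷ [])     = mk⇔ _ _
  AltUp-fromLehmer (l ∷ l′ ∷ L) =
    punchIn-self l l′
      ×-⇔ (AltDown-fromLehmer (l′ ∷ L) ⇔-∘ AltDown-map (punchIn l) (punchIn-mono-< l) (fromLehmer (l′ ∷ L)))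

ZigZag-applyUpTo : ∀ π (f : ℕ → ℕ) m →
  ZigZag π (applyUpTo f m) ⇔ (∀ {i} → suc i < m → CodeStep (π ℙ.+ parity i) (f i) (f (suc i)))
ZigZag-applyUpTo π f m = mk⇔ (to′ π f m) (from′ π f m)
  where
  shift : ∀ π i → π ⁻¹ ℙ.+ parity i ≡ π ℙ.+ parity (suc i)
  shift π i = trans (+-⁻¹-comm π (parity i)) (cong (π ℙ.+_) (sym (parity-suc i)))
  to′ : ∀ π f m → ZigZag π (applyUpTo f m) → ∀ {i} → suc i < m → CodeStep (π ℙ.+ parity i) (f i) (f (suc i))
  to′ π  f (suc zero)    _          (s≤s ())
  to′ 0ℙ f (suc (suc m)) (first , _) {zero}  _ = first
  to′ 1ℙ f (suc (suc m)) (first , _) {zero}  _ = first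
  to′ π  f (suc (suc m)) (_ , rest) {suc i} (s≤s i<) =
    subst (λ ρ → CodeStep ρ (f (suc i)) (f (suc (suc i)))) (shift π i) (to′ (π ⁻¹) (f ∘ suc) (suc m) rest i<)
  from′ : ∀ π f m → (∀ {i} → suc i < m → CodeStep (π ℙ.+ parity i) (f i) (f (suc i))) → ZigZag π (applyUpTo f m)
  from′ π  f zero          _     = tt
  from′ π  f (suc zero)    _     = tt
  from′ π  f (suc (suc m)) steps = first π steps , from′ (π ⁻¹) (f ∘ suc) (suc m)
    (λ {i} i< → subst (λ ρ → CodeStep ρ (f (suc i)) (f (suc (suc i)))) (sym (shift π i)) (steps (s≤s i<)))
    where
    first : ∀ π → (∀ {i} → suc i < suc (suc m) → CodeStep (π ℙ.+ parity i) (f i) (f (suc i))) → CodeStep π (f 0) (f 1)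
    first 0ℙ steps = steps (s≤s (s≤s z≤n))
    first 1ℙ steps = steps (s≤s (s≤s z≤n))

-- The Lehmer code of a cover at position p is the profile value b, reflected to m ∸ b when p is even.
codeEntry : Parity → ℕ → ℕ → ℕ
codeEntry 0ℙ m b = m ∸ b
codeEntry 1ℙ m b = b

codeEntry-≤ : ∀ π {m b} → b ≤ m → codeEntry π m b ≤ m
codeEntry-≤ 0ℙ {m} {b} _ = m∸n≤m m b
codeEntry-≤ 1ℙ         b≤m = b≤m

codeEntry-zero : ∀ π → codeEntry π 0 0 ≡ 0
codeEntry-zero 0ℙ = refl
codeEntry-zero 1ℙ = refl

codeEntry-involutive : ∀ π {m b} → b ≤ m → codeEntry π m (codeEntry π m b) ≡ b
codeEntry-involutive 0ℙ b≤m = m∸[m∸n]≡n b≤m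
codeEntry-involutive 1ℙ _   = refl

codeEntry-injective : ∀ π {m b b′} → b ≤ m → b′ ≤ m → codeEntry π m b ≡ codeEntry π m b′ → b ≡ b′
codeEntry-injective π b≤m b′≤m eq =
  trans (sym (codeEntry-involutive π b≤m)) (trans (cong (codeEntry π _) eq) (codeEntry-involutive π b′≤m))

-- Admissibility of two neighbouring profile values is exactly the alternation step of their code entries.
codeEntry-step : ∀ π {m b b′} → b′ + b ≤ m → CodeStep π (codeEntry π (suc m) b) (codeEntry (π ⁻¹) m b′)
codeEntry-step 0ℙ {m} {b} {b′} b′+b≤m =
  subst (b′ <_) (sym (+-∸-assoc 1 (≤-trans (m≤n+m b b′) b′+b≤m))) (s≤s (m+n≤o⇒m≤o∸n b′ b′+b≤m))
codeEntry-step 1ℙ {m} {b} {b′} b′+b≤m = m+n≤o⇒m≤o∸n b (subst (_≤ m) (+-comm b′ b) b′+b≤m)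

codeEntry-step⁻¹ : ∀ π {m l l′} → l ≤ suc m → l′ ≤ m → CodeStep π l l′ →
                   codeEntry (π ⁻¹) m l′ + codeEntry π (suc m) l ≤ m
codeEntry-step⁻¹ 0ℙ {m} {suc l} {l′} l≤ _ l′<l =
  subst (_≤ m) (+-comm (m ∸ l) l′)
        (m≤o∸n⇒m+n≤o (m ∸ l) (≤-trans (≤-pred l′<l) (≤-pred l≤)) (∸-monoʳ-≤ m (≤-pred l′<l)))
codeEntry-step⁻¹ 1ℙ {m} {l} {l′} _ l′≤m l≤l′ =
  ≤-trans (+-monoʳ-≤ (m ∸ l′) l≤l′) (≤-reflexive (m∸n+n≡m l′≤m))

codeEntry-min : ∀ π {m k b} → b ≤ k → codeEntry π m (codeEntry π k 0) ≤ codeEntry π m b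
codeEntry-min 0ℙ {m} b≤k = ∸-monoʳ-≤ m b≤k
codeEntry-min 1ℙ         _   = z≤n

Moves : Parity → ℕ → ℕ → Set
Moves 0ℙ a a′ = a ≡ suc a′
Moves 1ℙ a a′ = a′ ≡ suc a

moves-resp : ∀ {π ρ a b a′ b′} → π ≡ ρ → a ≡ b → a′ ≡ b′ → Moves π a a′ → Moves ρ b b′
moves-resp refl refl refl move = move

moves-+ : ∀ π {a a′ b b′} → Moves π a a′ → Moves (π ⁻¹) b b′ → a + b ≡ a′ + b′
moves-+ 0ℙ {a′ = a′} {b} refl refl = sym (+-suc a′ b)
moves-+ 1ℙ {a}  {b′ = b′} refl refl = +-suc a b′

moves-column : ∀ π {a a′ b b′} c → Moves π a a′ → Moves (π ⁻¹) b b′ → b′ + (a′ + c) ≡ b + (a + c)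
moves-column π {a} {a′} {b} {b′} c move move′ = begin
  b′ + (a′ + c) ≡⟨ rearrange b′ a′ c ⟩
  (a′ + b′) + c ≡⟨ cong (_+ c) (moves-+ π move move′) ⟨
  (a + b) + c   ≡⟨ rearrange b a c ⟨
  b + (a + c)   ∎
  where
  open ≡-Reasoning
  rearrange : ∀ x y z → x + (y + z) ≡ (y + x) + z
  rearrange = ℕ-solve-∀

moves-column′ : ∀ π {a a′ b b′} c → Moves π a a′ → Moves (π ⁻¹) b b′ → b′ + (c + a′) ≡ b + (c + a)
moves-column′ π {a} {a′} {b} {b′} c move move′ = begin
  b′ + (c + a′) ≡⟨ rearrange b′ c a′ ⟩
  c + (a′ + b′) ≡⟨ cong (c +_) (moves-+ π move move′) ⟨
  c + (a + b)   ≡⟨ rearrange b c a ⟨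
  b + (c + a)   ∎
  where
  open ≡-Reasoning
  rearrange : ∀ x y z → x + (y + z) ≡ y + (z + x)
  rearrange = ℕ-solve-∀

moves-+ˡ : ∀ π {a a′} c → Moves π a a′ → Moves π (a + c) (a′ + c)
moves-+ˡ 0ℙ c refl = refl
moves-+ˡ 1ℙ c refl = refl

moves-+ʳ : ∀ π {a a′} c → Moves π a a′ → Moves π (c + a) (c + a′)
moves-+ʳ 0ℙ {a′ = a′} c refl = +-suc c a′
moves-+ʳ 1ℙ {a}       c refl = +-suc c a

moves-∸ : ∀ π {m s s′} → s ≤ m → s′ ≤ m → Moves π s s′ → Moves (π ⁻¹) (m ∸ s) (m ∸ s′)
moves-∸ 0ℙ s≤m  _    refl = ∸-suc s≤m
moves-∸ 1ℙ _    s′≤m refl = ∸-suc s′≤m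

moves-codeEntry : ∀ π {m a a′} → a ≤ m → Moves π a a′ → codeEntry π m a′ ≡ suc (codeEntry π m a)
moves-codeEntry 0ℙ a≤m refl = ∸-suc a≤m
moves-codeEntry 1ℙ _   refl = refl

module _ where
  open import Data.Integer using (ℤ; +_; -_; _-_) renaming (_+_ to _+ℤ_)
  import Data.Integer.Properties as ℤ
  open import Data.Integer.Tactic.RingSolver using (solve-∀)

  signed : Parity → ℕ → ℤ
  signed 0ℙ x = + x
  signed 1ℙ x = - + x

  signed-zero : ∀ π → signed π 0 ≡ + 0
  signed-zero 0ℙ = refl
  signed-zero 1ℙ = refl

  signed-⁻¹ : ∀ π x → signed (π ⁻¹) x ≡ - signed π x
  signed-⁻¹ 0ℙ x = refl
  signed-⁻¹ 1ℙ x = sym (ℤ.neg-involutive (+ x))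

  altSum-take-suc : ∀ xs i → altSum (take (suc i) xs) ≡ altSum (take i xs) +ℤ signed (parity i) (at xs i)
  altSum-take-suc []       zero    = refl
  altSum-take-suc []       (suc i) = sym (cong (λ a → + 0 +ℤ a) (signed-zero (parity (suc i))))
  altSum-take-suc (x ∷ xs) zero    = identity (+ x)
    where
    identity : ∀ (a : ℤ) → a - + 0 ≡ + 0 +ℤ a
    identity = solve-∀
  altSum-take-suc (x ∷ xs) (suc i) = begin
    + x - altSum (take (suc i) xs)
      ≡⟨ cong (λ a → + x - a) (altSum-take-suc xs i) ⟩
    + x - (altSum (take i xs) +ℤ signed (parity i) (at xs i))
      ≡⟨ distrib (+ x) (altSum (take i xs)) _ ⟩
    (+ x - altSum (take i xs)) +ℤ - signed (parity i) (at xs i)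
      ≡⟨ cong (λ a → + x - altSum (take i xs) +ℤ a) (sym (signed-⁻¹ (parity i) (at xs i))) ⟩
    (+ x - altSum (take i xs)) +ℤ signed (parity i ⁻¹) (at xs i)
      ≡⟨ cong (λ π → + x - altSum (take i xs) +ℤ signed π (at xs i)) (sym (parity-suc i)) ⟩
    (+ x - altSum (take i xs)) +ℤ signed (parity (suc i)) (at xs i) ∎
    where
    open ≡-Reasoning
    distrib : ∀ (a b c : ℤ) → a - (b +ℤ c) ≡ (a - b) +ℤ - c
    distrib = solve-∀

  -- One more rung w on the running alternating sum, given the column equation w + b′ + b = m.
  altSum-step : ∀ π {m w b b′} h → w + (b′ + b) ≡ m →
                + (codeEntry π (suc m) b + h) +ℤ signed (π ⁻¹) w ≡ + (codeEntry (π ⁻¹) m b′ + (h + evenBit π))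
  altSum-step 0ℙ {m} {w} {b} {b′} h column = begin
    + (suc m ∸ b + h) +ℤ - + w       ≡⟨ cong (λ k → + (k + h) +ℤ - + w) suc-m∸b ⟩
    + (suc (w + b′) + h) +ℤ - + w    ≡⟨ cong (_+ℤ - + w) (cong +_ (solve-∀-ℕ w b′ h)) ⟩
    + (w + (b′ + (h + 1))) +ℤ - + w  ≡⟨ cong (_+ℤ - + w) (ℤ.pos-+ w (b′ + (h + 1))) ⟩
    (+ w +ℤ + (b′ + (h + 1))) +ℤ - + w ≡⟨ cancel (+ w) (+ (b′ + (h + 1))) ⟩
    + (b′ + (h + 1))                    ∎
    where
    open ≡-Reasoning
    suc-m∸b : suc m ∸ b ≡ suc (w + b′)
    suc-m∸b = begin
      suc m ∸ b                   ≡⟨ cong (λ k → suc k ∸ b) (trans (sym column) (sym (+-assoc w b′ b))) ⟩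
      suc (w + b′ + b) ∸ b        ≡⟨ m+n∸n≡m (suc (w + b′)) b ⟩
      suc (w + b′)                ∎
    solve-∀-ℕ : ∀ w b′ h → suc (w + b′) + h ≡ w + (b′ + (h + 1))
    solve-∀-ℕ = ℕ-solve-∀
    cancel : ∀ (a c : ℤ) → (a +ℤ c) +ℤ - a ≡ c
    cancel = solve-∀
  altSum-step 1ℙ {m} {w} {b} {b′} h column = begin
    + (b + h) +ℤ + w        ≡⟨ ℤ.pos-+ (b + h) w ⟨
    + (b + h + w)            ≡⟨ cong +_ rearrange ⟩
    + (m ∸ b′ + (h + 0))     ∎
    where
    open ≡-Reasoning
    rearrange : b + h + w ≡ m ∸ b′ + (h + 0)
    rearrange = trans (shuffle b h w) (cong (_+ (h + 0)) (sym m∸b′≡w+b))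
      where
      shuffle : ∀ b h w → b + h + w ≡ w + b + (h + 0)
      shuffle = ℕ-solve-∀
      m∸b′≡w+b : m ∸ b′ ≡ w + b
      m∸b′≡w+b = begin
        m ∸ b′
          ≡⟨ cong (_∸ b′) (trans (sym column) (trans (cong (λ k → w + k) (+-comm b′ b)) (sym (+-assoc w b b′)))) ⟩
        w + b + b′ ∸ b′
          ≡⟨ m+n∸n≡m (w + b) b′ ⟩
        w + b ∎

atFromRight : ∀ {m} → Vec ℕ m → ℕ → ℕ
atFromRight v = at (reverse (toList v))

fromRight : ∀ {m q} → q < m → Fin m
fromRight q<m = opposite (fromℕ< q<m)

toℕ-opposite-fromRight : ∀ {m q} (q<m : q < m) → toℕ (opposite (fromRight q<m)) ≡ q
toℕ-opposite-fromRight q<m = trans (cong toℕ (opposite-involutive _)) (toℕ-fromℕ< q<m)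

toℕ-opposite-injective : ∀ {m} {i j : Fin m} → toℕ (opposite i) ≡ toℕ (opposite j) → i ≡ j
toℕ-opposite-injective {i = i} {j} eq = begin
  i                     ≡⟨ opposite-involutive i ⟨
  opposite (opposite i) ≡⟨ cong opposite (toℕ-injective eq) ⟩
  opposite (opposite j) ≡⟨ opposite-involutive j ⟩
  j                     ∎
  where open ≡-Reasoning

toℕ-opposite-inject₁ : ∀ {m} (i : Fin m) → toℕ (opposite (inject₁ i)) ≡ suc (toℕ (opposite i))
toℕ-opposite-inject₁ {m} i = begin
  toℕ (opposite (inject₁ i)) ≡⟨ opposite-prop (inject₁ i) ⟩
  m ∸ toℕ (inject₁ i)        ≡⟨ cong (m ∸_) (toℕ-inject₁ i) ⟩
  m ∸ toℕ i                  ≡⟨ ∸-suc (toℕ<n i) ⟩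
  suc (m ∸ suc (toℕ i))      ≡⟨ cong suc (opposite-prop i) ⟨
  suc (toℕ (opposite i))     ∎
  where open ≡-Reasoning

toℕ-opposite-≤ : ∀ {m} (i : Fin (suc m)) → toℕ (opposite i) ≤ m
toℕ-opposite-≤ {m} i = ≤-pred (toℕ<n (opposite i))

toℕ≡∸opposite : ∀ {m} (k : Fin (suc m)) → toℕ k ≡ m ∸ toℕ (opposite k)
toℕ≡∸opposite {m} k = sym (trans (cong (m ∸_) (opposite-prop k)) (m∸[m∸n]≡n (≤-pred (toℕ<n k))))

at-toList : ∀ {m} (v : Vec ℕ m) (k : Fin m) → at (toList v) (toℕ k) ≡ lookup v k
at-toList (x Vec.∷ v) Fin.zero    = refl
at-toList (x Vec.∷ v) (Fin.suc k) = at-toList v k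

atFromRight-opposite : ∀ {m} (v : Vec ℕ m) (k : Fin m) → atFromRight v (toℕ (opposite k)) ≡ lookup v k
atFromRight-opposite {m} v k = begin
  at (reverse (toList v)) (toℕ (opposite k))
    ≡⟨ at-reverse (toList v) (subst (_ <_) (sym (length-toList v)) (toℕ<n (opposite k))) ⟩
  at (toList v) (length (toList v) ∸ suc (toℕ (opposite k)))
    ≡⟨ cong (λ l → at (toList v) (l ∸ suc (toℕ (opposite k)))) (length-toList v) ⟩
  at (toList v) (m ∸ suc (toℕ (opposite k)))
    ≡⟨ cong (at (toList v)) (trans (sym (opposite-prop (opposite k))) (cong toℕ (opposite-involutive k))) ⟩
  at (toList v) (toℕ k)
    ≡⟨ at-toList v k ⟩
  lookup v k ∎
  where open ≡-Reasoning

atFromRight-fromRight : ∀ {m q} (v : Vec ℕ m) (q<m : q < m) → atFromRight v q ≡ lookup v (fromRight q<m)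
atFromRight-fromRight v q<m =
  trans (cong (atFromRight v) (sym (toℕ-opposite-fromRight q<m))) (atFromRight-opposite v (fromRight q<m))

atFromRight-beyond : ∀ {m q} (v : Vec ℕ m) → m ≤ q → atFromRight v q ≡ 0
atFromRight-beyond v m≤q =
  at-beyond (reverse (toList v)) (subst (_≤ _) (sym (trans (length-reverse (toList v)) (length-toList v))) m≤q)

atFromRight-tabulate : ∀ {m q} (g : ℕ → ℕ) → q < m → atFromRight (tabulate {n = m} (g ∘ toℕ ∘ opposite)) q ≡ g q
atFromRight-tabulate g q<m =
  trans (atFromRight-fromRight (tabulate (g ∘ toℕ ∘ opposite)) q<m)
        (trans (lookup∘tabulate (g ∘ toℕ ∘ opposite) (fromRight q<m)) (cong g (toℕ-opposite-fromRight q<m)))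

atFromRight-injective : ∀ {m} (v w : Vec ℕ m) → (∀ {q} → q < m → atFromRight v q ≡ atFromRight w q) → v ≡ w
atFromRight-injective v w v≡w = begin
  v                   ≡⟨ tabulate∘lookup v ⟨
  tabulate (lookup v) ≡⟨ tabulate-cong lookup≡ ⟩
  tabulate (lookup w) ≡⟨ tabulate∘lookup w ⟩
  w                   ∎
  where
  open ≡-Reasoning
  lookup≡ : ∀ k → lookup v k ≡ lookup w k
  lookup≡ k = trans (sym (atFromRight-opposite v k)) (trans (v≡w (toℕ<n (opposite k))) (atFromRight-opposite w k))

colour : ℕ → Row → ℕ → Parity
colour N r k = parity (rowIdx r + k + N)

module _ {N : ℕ} {f : Fin N} where

  onFace-hE : ∀ {r j} → OnFace f (hE r j) → j ≡ f
  onFace-hE (_ , _ , here refl)                        = refl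
  onFace-hE (_ , _ , there (there (here refl)))        = refl
  onFace-hE (_ , _ , there (here ()))
  onFace-hE (_ , _ , there (there (there (here ()))))
  onFace-hE (_ , _ , there (there (there (there ()))))

  onFace-vE : ∀ {k} → OnFace f (vE k) → k ≡ Fin.suc f ⊎ k ≡ inject₁ f
  onFace-vE (_ , _ , here ())
  onFace-vE (_ , _ , there (here refl))                 = inj₁ refl
  onFace-vE (_ , _ , there (there (here ())))
  onFace-vE (_ , _ , there (there (there (here refl)))) = inj₂ refl
  onFace-vE (_ , _ , there (there (there (there ()))))

  hE-onFace : ∀ r → OnFace f (hE r f)
  hE-onFace bot = bot , _ , here refl
  hE-onFace top = top , _ , there (there (here refl))

  vE-suc-onFace : OnFace f (vE (Fin.suc f))
  vE-suc-onFace = bot , _ , there (here refl)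

  vE-inject₁-onFace : OnFace f (vE (inject₁ f))
  vE-inject₁-onFace = top , _ , there (there (there (here refl)))

  -- colour N r k ⁻¹ is 1ℙ, i.e. the edge is raised, exactly when its starting vertex is black.
  twist⇒moves : ∀ {ω ω′} → Twist f ω ω′ → ∀ {e r k} → (e , r , k) ∈ boundary f →
                Moves (colour N r k ⁻¹) (mult ω e) (mult ω′ e)
  twist⇒moves (_ , odd , even , _) {e} {r} {k} e∈ with colour N r k in c
  ... | 0ℙ = even e (r , k , e∈ , from (%2≡0⇔parity≡0ℙ (rowIdx r + k + N)) c)
  ... | 1ℙ = sym (odd e (r , k , e∈ , λ black →
                   0ℙ≢1ℙ (trans (sym (to (%2≡0⇔parity≡0ℙ (rowIdx r + k + N)) black)) c)))
    where
    0ℙ≢1ℙ : 0ℙ ≢ 1ℙ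
    0ℙ≢1ℙ ()

  moves⇒twist : ∀ {ω ω′} →
                (∀ {e r k} → (e , r , k) ∈ boundary f → Moves (colour N r k ⁻¹) (mult ω e) (mult ω′ e)) →
                (∀ e → ¬ OnFace f e → mult ω′ e ≡ mult ω e) → Twist f ω ω′
  moves⇒twist {ω} {ω′} moves off = (λ e oddE → subst (1 ≤_) (odd e oddE) (s≤s z≤n)) , odd , even , off
    where
    odd : ∀ e → OddEdge f e → suc (mult ω′ e) ≡ mult ω e
    odd e (r , k , e∈ , white) with colour N r k in c
    ... | 0ℙ = ⊥-elim (white (from (%2≡0⇔parity≡0ℙ (rowIdx r + k + N)) c))
    ... | 1ℙ = sym (subst (λ π → Moves (π ⁻¹) (mult ω e) (mult ω′ e)) c (moves e∈))
    even : ∀ e → EvenEdge f e → mult ω′ e ≡ suc (mult ω e)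
    even e (r , k , e∈ , black) =
      subst (λ π → Moves (π ⁻¹) (mult ω e) (mult ω′ e)) (to (%2≡0⇔parity≡0ℙ (rowIdx r + k + N)) black) (moves e∈)

allLists-unique : ∀ m b → Unique (allLists m b)
allLists-unique zero    b = [] ∷ []
allLists-unique (suc m) b =
  unique-concatMap _ (λ σ → at σ 0) head≡ (Unique.upTo⁺ b) (λ x → Unique.map⁺ ∷-injectiveʳ (allLists-unique m b))
  where
  head≡ : ∀ {x σ} → σ ∈ map (x ∷_) (allLists m b) → at σ 0 ≡ x
  head≡ {x} σ∈ with ∈-map⁻ (x ∷_) σ∈
  ... | _ , _ , refl = refl

allLists-complete : ∀ m b {σ} → length σ ≡ m → All (_< b) σ → σ ∈ allLists m b
allLists-complete zero    b {[]}    refl []           = here refl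
allLists-complete (suc m) b {x ∷ σ} len  (x<b ∷ σ<b) =
  ∈-concatMap⁺ (λ y → map (y ∷_) (allLists m b))
    (Any.map (λ { refl → ∈-map⁺ (x ∷_) (allLists-complete m b (suc-injective len) σ<b) }) (∈-upTo⁺ x<b))

allVecs-unique : ∀ m b → Unique (allVecs m b)
allVecs-unique zero    b = [] ∷ []
allVecs-unique (suc m) b =
  unique-concatMap _ Vec.head head≡ (Unique.upTo⁺ b) (λ x → Unique.map⁺ Vec.∷-injectiveʳ (allVecs-unique m b))
  where
  head≡ : ∀ {x v} → v ∈ map (x Vec.∷_) (allVecs m b) → Vec.head v ≡ x
  head≡ {x} v∈ with ∈-map⁻ (x Vec.∷_) v∈
  ... | _ , _ , refl = refl

allVecs-complete : ∀ m b (v : Vec ℕ m) → (∀ k → lookup v k < b) → v ∈ allVecs m b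
allVecs-complete zero    b Vec.[]       _      = here refl
allVecs-complete (suc m) b (x Vec.∷ v) bounded =
  ∈-concatMap⁺ (λ y → map (y Vec.∷_) (allVecs m b))
    (Any.map (λ { refl → ∈-map⁺ (x Vec.∷_) (allVecs-complete m b v (bounded ∘ Fin.suc)) }) (∈-upTo⁺ (bounded Fin.zero)))

altPerms-unique : ∀ n → Unique (altPerms n)
altPerms-unique n = Unique.filter⁺ (λ σ → isPerm? n σ ×-dec altDown? σ) (allLists-unique n n)

∈-altPerms : ∀ n σ → σ ∈ altPerms n ⇔ (IsPerm n σ × Alternating σ)
∈-altPerms n σ = mk⇔ (proj₂ ∘ ∈-filter⁻ P? {xs = allLists n n})
                     (λ (perm@(len , bounded , _) , alternating) →
                        ∈-filter⁺ P? {xs = allLists n n} (allLists-complete n n len bounded) (perm , alternating))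
  where
  P? = λ σ → isPerm? n σ ×-dec altDown? σ

module _ {N : ℕ} where

  private
    rowVectors : List (Vec ℕ N)
    rowVectors = allVecs N (suc (suc N))

    withRungs : Vec ℕ (suc N) → List (Cover N)
    withRungs v = concatMap (λ b → map (cover v b) rowVectors) rowVectors

  coverCandidates : List (Cover N)
  coverCandidates = concatMap withRungs (allVecs (suc N) (suc (suc N)))

  coverList-unique : Unique (coverList N)
  coverList-unique = Unique.filter⁺ isCover? {xs = coverCandidates}
    (unique-concatMap withRungs vert vert≡ (allVecs-unique (suc N) (suc (suc N))) λ v →
       unique-concatMap _ botH botH≡ (allVecs-unique N (suc (suc N))) λ b →
         Unique.map⁺ (cong topH) (allVecs-unique N (suc (suc N))))
    where
    botH≡ : ∀ {b ω v} → ω ∈ map (cover v b) rowVectors → botH ω ≡ b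
    botH≡ {b} {v = v} ω∈ with ∈-map⁻ (cover v b) ω∈
    ... | _ , _ , refl = refl
    vert≡ : ∀ {v ω} → ω ∈ withRungs v → vert ω ≡ v
    vert≡ {v} ω∈ with Any.satisfied (∈-concatMap⁻ (λ b → map (cover v b) rowVectors) {xs = rowVectors} ω∈)
    ... | b , ω∈′ with ∈-map⁻ (cover v b) ω∈′
    ...   | _ , _ , refl = refl

  -- Every multiplicity is at most the label N + 1 of an endpoint.
  ∈-coverList : ∀ ω → IsCover ω → ω ∈ coverList N
  ∈-coverList ω isCover = ∈-filter⁺ isCover? {xs = coverCandidates} candidate isCover
    where
    vertical : ∀ k → lookup (vert ω) k < suc (suc N)
    vertical k = s≤s (≤-trans (≤-trans (m≤m+n (mult ω (vE k)) _) (≤-reflexive (isCover bot k))) (s≤s (≤-pred (toℕ<n k))))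
    horizontal : ∀ r j → mult ω (hE r j) < suc (suc N)
    horizontal r j = s≤s (begin
      mult ω (hE r j)                                                 ≤⟨ m≤m+n (mult ω (hE r j)) _ ⟩
      mult ω (hE r j) + sum (map (mult ω) (rightEdge r (Fin.suc j))) ≤⟨ m≤n+m _ (mult ω (vE (Fin.suc j))) ⟩
      sum (map (mult ω) (incident r (Fin.suc j)))                     ≡⟨ isCover r (Fin.suc j) ⟩
      suc (suc (toℕ j))                                               ≤⟨ s≤s (toℕ<n j) ⟩
      suc N                                                           ∎)
      where open ≤-Reasoning
    candidate : ω ∈ coverCandidates
    candidate =
      ∈-concatMap⁺ withRungs (Any.map (λ { refl →
        ∈-concatMap⁺ _ (Any.map (λ { refl → ∈-map⁺ (cover (vert ω) (botH ω)) (allVecs-complete N _ (topH ω) (horizontal top)) })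
                                (allVecs-complete N _ (botH ω) (horizontal bot))) })
        (allVecs-complete (suc N) _ (vert ω) vertical))

prev : (ℕ → ℕ) → ℕ → ℕ
prev g zero    = 0
prev g (suc q) = g q

module Ladder (N : ℕ) where

  row : Cover N → Row → Vec ℕ N
  row ω bot = botH ω
  row ω top = topH ω

  -- Columns are counted from the right: W ω q is the rung at column N - q, so W ω q = ℓ_{q+1},
  -- and H ω r q is the edge of row r joining columns N - q - 1 and N - q.
  W : Cover N → ℕ → ℕ
  W ω = atFromRight (vert ω)

  H : Cover N → Row → ℕ → ℕ
  H ω r = atFromRight (row ω r)

  H-beyond : ∀ ω r {q} → N ≤ q → H ω r q ≡ 0
  H-beyond ω r = atFromRight-beyond (row ω r)

  W-beyond : ∀ ω {q} → suc N ≤ q → W ω q ≡ 0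
  W-beyond ω = atFromRight-beyond (vert ω)

  mult-vE : ∀ ω k → mult ω (vE k) ≡ W ω (toℕ (opposite k))
  mult-vE ω k = sym (atFromRight-opposite (vert ω) k)

  mult-hE : ∀ ω r j → mult ω (hE r j) ≡ H ω r (toℕ (opposite j))
  mult-hE ω bot j = sym (atFromRight-opposite (botH ω) j)
  mult-hE ω top j = sym (atFromRight-opposite (topH ω) j)

  columnSum : Cover N → Row → ℕ → ℕ
  columnSum ω r q = W ω q + (H ω r q + prev (H ω r) q)

  incident-sum : ∀ ω r k → sum (map (mult ω) (incident r k)) ≡ columnSum ω r (toℕ (opposite k))
  incident-sum ω r k = cong₂ _+_ (mult-vE ω k) (begin
    sum (map (mult ω) (leftEdge r k ++ rightEdge r k))
      ≡⟨ cong sum (map-++ (mult ω) (leftEdge r k) (rightEdge r k)) ⟩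
    sum (map (mult ω) (leftEdge r k) ++ map (mult ω) (rightEdge r k))
      ≡⟨ sum-++ (map (mult ω) (leftEdge r k)) _ ⟩
    sum (map (mult ω) (leftEdge r k)) + sum (map (mult ω) (rightEdge r k))
      ≡⟨ cong₂ _+_ (left k) (right k) ⟩
    H ω r (toℕ (opposite k)) + prev (H ω r) (toℕ (opposite k)) ∎)
    where
    open ≡-Reasoning
    left : ∀ k → sum (map (mult ω) (leftEdge r k)) ≡ H ω r (toℕ (opposite k))
    left Fin.zero    = sym (H-beyond ω r (≤-reflexive (sym (toℕ-fromℕ N))))
    left (Fin.suc j) = trans (+-identityʳ _) (trans (mult-hE ω r j) (cong (H ω r) (sym (opposite-suc j))))
    right : ∀ k → sum (map (mult ω) (rightEdge r k)) ≡ prev (H ω r) (toℕ (opposite k))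
    right k with toℕ k <? N
    ... | yes k<N = trans (+-identityʳ _) (trans (mult-hE ω r (fromℕ< k<N)) (cong (prev (H ω r)) (sym opposite-k)))
      where
      opposite-k : toℕ (opposite k) ≡ suc (toℕ (opposite (fromℕ< k<N)))
      opposite-k = begin
        toℕ (opposite k)                    ≡⟨ opposite-prop k ⟩
        N ∸ toℕ k                           ≡⟨ ∸-suc k<N ⟩
        suc (N ∸ suc (toℕ k))               ≡⟨ cong (λ i → suc (N ∸ suc i)) (toℕ-fromℕ< k<N) ⟨
        suc (N ∸ suc (toℕ (fromℕ< k<N)))    ≡⟨ cong suc (opposite-prop (fromℕ< k<N)) ⟨
        suc (toℕ (opposite (fromℕ< k<N)))   ∎
    ... | no k≮N = cong (prev (H ω r)) (sym (trans (opposite-prop k) (m≤n⇒m∸n≡0 (≮⇒≥ k≮N))))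

  ColumnSums : Cover N → Set
  ColumnSums ω = ∀ r {q} → q ≤ N → columnSum ω r q ≡ suc (N ∸ q)

  isCover⇔columnSums : ∀ ω → IsCover ω ⇔ ColumnSums ω
  isCover⇔columnSums ω = mk⇔ to′ from′
    where
    open ≡-Reasoning
    to′ : IsCover ω → ColumnSums ω
    to′ isCover r {q} q≤N = begin
      columnSum ω r q
        ≡⟨ cong (columnSum ω r) (toℕ-opposite-fromRight (s≤s q≤N)) ⟨
      columnSum ω r (toℕ (opposite k))
        ≡⟨ incident-sum ω r k ⟨
      sum (map (mult ω) (incident r k))
        ≡⟨ isCover r k ⟩
      suc (toℕ k)
        ≡⟨ cong suc (trans (toℕ≡∸opposite k) (cong (N ∸_) (toℕ-opposite-fromRight (s≤s q≤N)))) ⟩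
      suc (N ∸ q) ∎
      where k = fromRight (s≤s q≤N)
    from′ : ColumnSums ω → IsCover ω
    from′ sums r k = begin
      sum (map (mult ω) (incident r k))      ≡⟨ incident-sum ω r k ⟩
      columnSum ω r (toℕ (opposite k))       ≡⟨ sums r (toℕ-opposite-≤ k) ⟩
      suc (N ∸ toℕ (opposite k))             ≡⟨ cong suc (toℕ≡∸opposite k) ⟨
      suc (toℕ k)                            ∎

  columnSums : ∀ ω → IsCover ω → ColumnSums ω
  columnSums ω = to (isCover⇔columnSums ω)

  profile : Cover N → ℕ → ℕ
  profile ω = H ω bot

  Admissible : (ℕ → ℕ) → Set
  Admissible g = (∀ {q} → q < N → g (suc q) + g q ≤ N ∸ q) × (∀ {q} → N ≤ q → g q ≡ 0)

  admissible-≤ : ∀ {g} → Admissible g → ∀ q → g q ≤ N ∸ q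
  admissible-≤ {g} (pairs , beyond) q with q <? N
  ... | yes q<N = ≤-trans (m≤n+m (g q) (g (suc q))) (pairs q<N)
  ... | no  q≮N = ≤-reflexive (trans (beyond (≮⇒≥ q≮N)) (sym (m≤n⇒m∸n≡0 (≮⇒≥ q≮N))))

  admissible-prev : ∀ {g} → Admissible g → ∀ {q} → q ≤ N → g q + prev g q ≤ suc (N ∸ q)
  admissible-prev {g} adm {zero}  _     = ≤-trans (≤-reflexive (+-identityʳ (g 0))) (≤-trans (admissible-≤ adm 0) (n≤1+n N))
  admissible-prev {g} adm {suc q} q<N   = subst (g (suc q) + g q ≤_) (∸-suc q<N) (proj₁ adm q<N)

  H-top≡bot : ∀ ω → ColumnSums ω → ∀ q → H ω top q ≡ H ω bot q
  H-top≡bot ω sums q with q ≤? N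
  ... | yes q≤N = go q q≤N
    where
    same : ∀ {q} → q ≤ N → H ω top q + prev (H ω top) q ≡ H ω bot q + prev (H ω bot) q
    same q≤N = +-cancelˡ-≡ (W ω _) _ _ (trans (sums top q≤N) (sym (sums bot q≤N)))
    go : ∀ q → q ≤ N → H ω top q ≡ H ω bot q
    go zero    q≤N = +-cancelʳ-≡ 0 _ _ (same q≤N)
    go (suc q) q≤N =
      +-cancelʳ-≡ (H ω bot q) _ _ (trans (cong (H ω top (suc q) +_) (sym (go q (≤-trans (n≤1+n q) q≤N)))) (same q≤N))
  ... | no q≰N = trans (H-beyond ω top (<⇒≤ (≰⇒> q≰N))) (sym (H-beyond ω bot (<⇒≤ (≰⇒> q≰N))))

  H≡profile : ∀ ω → ColumnSums ω → ∀ r q → H ω r q ≡ profile ω q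
  H≡profile ω sums bot q = refl
  H≡profile ω sums top q = H-top≡bot ω sums q

  profile-admissible : ∀ ω → ColumnSums ω → Admissible (profile ω)
  profile-admissible ω sums = pairs , H-beyond ω bot
    where
    pairs : ∀ {q} → q < N → profile ω (suc q) + profile ω q ≤ N ∸ q
    pairs {q} q<N = subst (profile ω (suc q) + profile ω q ≤_) (trans (sums bot q<N) (sym (∸-suc q<N)))
                                 (m≤n+m _ (W ω (suc q)))

  rungOf : (ℕ → ℕ) → ℕ → ℕ
  rungOf g q = suc (N ∸ q) ∸ (g q + prev g q)

  W≡rungOf : ∀ ω → ColumnSums ω → ∀ {q} → q ≤ N → W ω q ≡ rungOf (profile ω) q
  W≡rungOf ω sums {q} q≤N =
    sym (trans (cong (_∸ (profile ω q + prev (profile ω) q)) (sym (sums bot q≤N)))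
               (m+n∸n≡m (W ω q) (profile ω q + prev (profile ω) q)))

  profile-injective : ∀ ω ω′ → ColumnSums ω → ColumnSums ω′ →
                      (∀ {q} → q < N → profile ω q ≡ profile ω′ q) → ω ≡ ω′
  profile-injective ω ω′ sums sums′ same = trans
    (cong₂ (λ v b → cover v b (topH ω)) (atFromRight-injective (vert ω) (vert ω′) W≡)
                                         (atFromRight-injective (botH ω) (botH ω′) same))
    (cong (cover (vert ω′) (botH ω′)) (atFromRight-injective (topH ω) (topH ω′) top≡))
    where
    same′ : ∀ q → profile ω q ≡ profile ω′ q
    same′ q with q <? N
    ... | yes q<N = same q<N
    ... | no  q≮N = trans (H-beyond ω bot (≮⇒≥ q≮N)) (sym (H-beyond ω′ bot (≮⇒≥ q≮N)))
    prev≡ : ∀ q → prev (profile ω) q ≡ prev (profile ω′) q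
    prev≡ zero    = refl
    prev≡ (suc q) = same′ q
    W≡ : ∀ {q} → q < suc N → W ω q ≡ W ω′ q
    W≡ {q} (s≤s q≤N) = begin
      W ω q                   ≡⟨ W≡rungOf ω sums q≤N ⟩
      rungOf (profile ω) q    ≡⟨ cong (λ s → suc (N ∸ q) ∸ s) (cong₂ _+_ (same′ q) (prev≡ q)) ⟩
      rungOf (profile ω′) q   ≡⟨ W≡rungOf ω′ sums′ q≤N ⟨
      W ω′ q                  ∎
      where open ≡-Reasoning
    top≡ : ∀ {q} → q < N → H ω top q ≡ H ω′ top q
    top≡ {q} q<N = trans (H-top≡bot ω sums q) (trans (same q<N) (sym (H-top≡bot ω′ sums′ q)))

  fromProfile : (ℕ → ℕ) → Cover N
  fromProfile g = cover (tabulate (rungOf g ∘ toℕ ∘ opposite))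
                        (tabulate (g ∘ toℕ ∘ opposite))
                        (tabulate (g ∘ toℕ ∘ opposite))

  H-fromProfile : ∀ {g} → Admissible g → ∀ r q → H (fromProfile g) r q ≡ g q
  H-fromProfile {g} adm r q with q <? N
  ... | no  q≮N = trans (H-beyond (fromProfile g) r (≮⇒≥ q≮N)) (sym (proj₂ adm (≮⇒≥ q≮N)))
  H-fromProfile {g} adm bot q | yes q<N = atFromRight-tabulate g q<N
  H-fromProfile {g} adm top q | yes q<N = atFromRight-tabulate g q<N

  W-fromProfile : ∀ g {q} → q ≤ N → W (fromProfile g) q ≡ rungOf g q
  W-fromProfile g q≤N = atFromRight-tabulate (rungOf g) (s≤s q≤N)

  fromProfile-columnSums : ∀ {g} → Admissible g → ColumnSums (fromProfile g)
  fromProfile-columnSums {g} adm r {q} q≤N = begin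
    W ω q + (H ω r q + prev (H ω r) q) ≡⟨ cong₂ _+_ (W-fromProfile g q≤N) (cong₂ _+_ (H-fromProfile adm r q) (prev-H q)) ⟩
    rungOf g q + (g q + prev g q)      ≡⟨ m∸n+n≡m (admissible-prev adm q≤N) ⟩
    suc (N ∸ q)                        ∎
    where
    open ≡-Reasoning
    ω = fromProfile g
    prev-H : ∀ q → prev (H ω r) q ≡ prev g q
    prev-H zero    = refl
    prev-H (suc q) = H-fromProfile adm r q

  n : ℕ
  n = suc (suc N)

  codeAt : (ℕ → ℕ) → ℕ → ℕ
  codeAt g p = codeEntry (parity p) (suc N ∸ p) (g p)

  codeOf : (ℕ → ℕ) → List ℕ
  codeOf g = applyUpTo (codeAt g) n

  code : Cover N → List ℕ
  code ω = codeOf (profile ω)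

  φ : Cover N → List ℕ
  φ ω = fromLehmer (code ω)

  admissible-pair : ∀ {g} → Admissible g → ∀ {q} → q ≤ N → g (suc q) + g q ≤ N ∸ q
  admissible-pair {g} adm {q} q≤N with m≤n⇒m<n∨m≡n q≤N
  ... | inj₁ q<N  = proj₁ adm q<N
  ... | inj₂ refl = ≤-reflexive (trans (cong₂ _+_ (proj₂ adm (n≤1+n N)) (proj₂ adm ≤-refl)) (sym (n∸n≡0 N)))

  <N⇒<n : ∀ {q} → q < N → q < n
  <N⇒<n q<N = ≤-trans q<N (≤-trans (n≤1+n N) (n≤1+n (suc N)))

  admissible-≤-suc : ∀ {g} → Admissible g → ∀ p → g p ≤ suc N ∸ p
  admissible-≤-suc adm p = ≤-trans (admissible-≤ adm p) (∸-monoˡ-≤ p (n≤1+n N))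

  codeAt-≤ : ∀ {g} → Admissible g → ∀ p → codeAt g p ≤ suc N ∸ p
  codeAt-≤ adm p = codeEntry-≤ (parity p) (admissible-≤-suc adm p)

  codeOf-isLehmerCode : ∀ {g} → Admissible g → IsLehmerCode (codeOf g)
  codeOf-isLehmerCode adm = from (IsLehmerCode-applyUpTo _ n) (λ {p} _ → codeAt-≤ adm p)

  codeOf-zigzag : ∀ {g} → Admissible g → ZigZag 0ℙ (codeOf g)
  codeOf-zigzag {g} adm = from (ZigZag-applyUpTo 0ℙ (codeAt g) n) codeStep
    where
    codeStep : ∀ {p} → suc p < n → CodeStep (parity p) (codeAt g p) (codeAt g (suc p))
    codeStep {p} (s≤s (s≤s p≤N)) =
      subst₂ (λ m π → CodeStep (parity p) (codeEntry (parity p) m (g p)) (codeEntry π (N ∸ p) (g (suc p))))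
             (sym (+-∸-assoc 1 p≤N)) (sym (parity-suc p))
             (codeEntry-step (parity p) (admissible-pair adm p≤N))

  lehmer-φ : ∀ ω → ColumnSums ω → lehmer (φ ω) ≡ code ω
  lehmer-φ ω sums = lehmer-fromLehmer (code ω) (codeOf-isLehmerCode (profile-admissible ω sums))

  φ-isPerm : ∀ ω → ColumnSums ω → IsPerm n (φ ω)
  φ-isPerm ω sums = subst (λ m → IsPerm m (φ ω)) (length-applyUpTo (codeAt (profile ω)) n)
                          (fromLehmer-isPerm (code ω) (codeOf-isLehmerCode (profile-admissible ω sums)))

  φ-alternating : ∀ ω → ColumnSums ω → Alternating (φ ω)
  φ-alternating ω sums = from (AltDown-fromLehmer (code ω)) (codeOf-zigzag (profile-admissible ω sums))

  code-injective : ∀ ω ω′ → ColumnSums ω → ColumnSums ω′ →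
                   (∀ {p} → p < N → codeAt (profile ω) p ≡ codeAt (profile ω′) p) → ω ≡ ω′
  code-injective ω ω′ sums sums′ same = profile-injective ω ω′ sums sums′ λ {p} p<N →
    codeEntry-injective (parity p) (admissible-≤-suc (profile-admissible ω sums) p)
                                   (admissible-≤-suc (profile-admissible ω′ sums′) p) (same p<N)

  φ-injective : ∀ ω ω′ → ColumnSums ω → ColumnSums ω′ → φ ω ≡ φ ω′ → ω ≡ ω′
  φ-injective ω ω′ sums sums′ eq = code-injective ω ω′ sums sums′ λ p<N →
    applyUpTo-injective {codeAt (profile ω)} {codeAt (profile ω′)} n code≡ (<N⇒<n p<N)
    where
    code≡ : code ω ≡ code ω′
    code≡ = trans (sym (lehmer-φ ω sums)) (trans (cong lehmer eq) (lehmer-φ ω′ sums′))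

  -- The zigzag shape forces the profile read off the code to vanish at positions N and N + 1.
  codeOf-surjective : ∀ L → length L ≡ n → IsLehmerCode L → ZigZag 0ℙ L →
                      Σ[ g ∈ (ℕ → ℕ) ] Admissible g × codeOf g ≡ L
  codeOf-surjective L len valid zigzag = g , (pairs ∘ <⇒≤ , beyond) , code≡
    where
    ℓ = at L
    L≡ : applyUpTo ℓ n ≡ L
    L≡ = trans (cong (applyUpTo ℓ) (sym len)) (applyUpTo-at L)
    bound : ∀ {p} → p < n → ℓ p ≤ suc N ∸ p
    bound = to (IsLehmerCode-applyUpTo ℓ n) (subst IsLehmerCode (sym L≡) valid)
    codeStep : ∀ {p} → suc p < n → CodeStep (parity p) (ℓ p) (ℓ (suc p))
    codeStep = to (ZigZag-applyUpTo 0ℙ ℓ n) (subst (ZigZag 0ℙ) (sym L≡) zigzag)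
    g : ℕ → ℕ
    g = codeAt ℓ
    pairs : ∀ {q} → q ≤ N → g (suc q) + g q ≤ N ∸ q
    pairs {q} q≤N =
      subst₂ (λ π m → codeEntry π (N ∸ q) (ℓ (suc q)) + codeEntry (parity q) m (ℓ q) ≤ N ∸ q)
             (sym (parity-suc q)) (sym (+-∸-assoc 1 q≤N))
             (codeEntry-step⁻¹ (parity q) (subst (ℓ q ≤_) (+-∸-assoc 1 q≤N) (bound (s≤s (m≤n⇒m≤1+n q≤N))))
                               (bound (s≤s (s≤s q≤N))) (codeStep (s≤s (s≤s q≤N))))
    last-two : g (suc N) + g N ≤ 0
    last-two = subst (g (suc N) + g N ≤_) (n∸n≡0 N) (pairs ≤-refl)
    beyond : ∀ {q} → N ≤ q → g q ≡ 0
    beyond {q} N≤q with m≤n⇒m<n∨m≡n N≤q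
    ... | inj₂ refl = n≤0⇒n≡0 (≤-trans (m≤n+m (g N) (g (suc N))) last-two)
    ... | inj₁ N<q with m≤n⇒m<n∨m≡n N<q
    ...   | inj₂ refl = n≤0⇒n≡0 (≤-trans (m≤m+n (g (suc N)) (g N)) last-two)
    ...   | inj₁ 1+N<q = begin
      codeEntry (parity q) (suc N ∸ q) (ℓ q) ≡⟨ cong₂ (codeEntry (parity q)) (m≤n⇒m∸n≡0 (<⇒≤ 1+N<q))
                                                  (at-beyond L (subst (_≤ q) (sym len) 1+N<q)) ⟩
      codeEntry (parity q) 0 0              ≡⟨ codeEntry-zero (parity q) ⟩
      0                                     ∎
      where open ≡-Reasoning
    code≡ : codeOf g ≡ L
    code≡ = trans (applyUpTo-cong n (λ {p} p<n → codeEntry-involutive (parity p) (bound p<n))) L≡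

  φ-surjective : ∀ σ → IsPerm n σ → Alternating σ → Σ[ ω ∈ Cover N ] IsCover ω × φ ω ≡ σ
  φ-surjective σ isPerm alternating = ω , from (isCover⇔columnSums ω) (fromProfile-columnSums adm) , φω≡σ
    where
    lehmer-σ = fromLehmer-lehmer n σ isPerm
    valid = proj₁ lehmer-σ
    σ≡ = proj₂ lehmer-σ
    zigzag : ZigZag 0ℙ (lehmer σ)
    zigzag = to (AltDown-fromLehmer (lehmer σ)) (subst AltDown (sym σ≡) alternating)
    preimage = codeOf-surjective (lehmer σ) (trans (length-lehmer σ) (proj₁ isPerm)) valid zigzag
    g = proj₁ preimage
    adm = proj₁ (proj₂ preimage)
    ω = fromProfile g
    φω≡σ : φ ω ≡ σ
    φω≡σ = begin
      fromLehmer (codeOf (profile ω))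
        ≡⟨ cong fromLehmer (applyUpTo-cong n (λ {p} _ → cong (codeEntry (parity p) (suc N ∸ p)) (H-fromProfile adm bot p))) ⟩
      fromLehmer (codeOf g)
        ≡⟨ cong fromLehmer (proj₂ (proj₂ preimage)) ⟩
      fromLehmer (lehmer σ)
        ≡⟨ σ≡ ⟩
      σ ∎
      where open ≡-Reasoning

  module _ where
    open import Data.Integer using (+_; _-_) renaming (_+_ to _+ℤ_)
    import Data.Integer.Properties as ℤ
    open import Data.Integer.Tactic.RingSolver using (solve-∀)

    altSum-ells : ∀ ω → ColumnSums ω → ∀ {p} → p ≤ N →
                  altSum (take (suc p) (ells ω)) ≡ + (codeAt (profile ω) p + ⌊ suc p /2⌋)
    altSum-ells ω sums {zero} _ = begin
      altSum (take 1 (ells ω))      ≡⟨ altSum-take-suc (ells ω) 0 ⟩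
      + W ω 0                       ≡⟨ cong +_ (W≡rungOf ω sums z≤n) ⟩
      + (suc N ∸ (B 0 + 0))         ≡⟨ cong (λ k → + (suc N ∸ k)) (+-identityʳ (B 0)) ⟩
      + (suc N ∸ B 0)               ≡⟨ cong +_ (+-identityʳ (suc N ∸ B 0)) ⟨
      + (suc N ∸ B 0 + 0)           ∎
      where
      open ≡-Reasoning
      B = profile ω
    altSum-ells ω sums {suc p} p<N = begin
      altSum (take (suc (suc p)) (ells ω))
        ≡⟨ altSum-take-suc (ells ω) (suc p) ⟩
      altSum (take (suc p) (ells ω)) +ℤ signed (parity (suc p)) (W ω (suc p))
        ≡⟨ cong₂ _+ℤ_ (altSum-ells ω sums (<⇒≤ p<N)) (cong (λ π → signed π (W ω (suc p))) (parity-suc p)) ⟩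
      + (codeEntry (parity p) (suc N ∸ p) (B p) + ⌊ suc p /2⌋) +ℤ signed (parity p ⁻¹) (W ω (suc p))
        ≡⟨ cong (λ m → + (codeEntry (parity p) m (B p) + ⌊ suc p /2⌋) +ℤ signed (parity p ⁻¹) (W ω (suc p))) (+-∸-assoc 1 (<⇒≤ p<N)) ⟩
      + (codeEntry (parity p) (suc (N ∸ p)) (B p) + ⌊ suc p /2⌋) +ℤ signed (parity p ⁻¹) (W ω (suc p))
        ≡⟨ altSum-step (parity p) ⌊ suc p /2⌋ (trans (sums bot p<N) (sym (∸-suc p<N))) ⟩
      + (codeEntry (parity p ⁻¹) (N ∸ p) (B (suc p)) + (⌊ suc p /2⌋ + evenBit (parity p)))
        ≡⟨ cong₂ (λ π k → + (codeEntry π (N ∸ p) (B (suc p)) + k)) (sym (parity-suc p)) (sym (⌊2+p/2⌋ p)) ⟩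
      + (codeAt B (suc p) + ⌊ suc (suc p) /2⌋)
        ∎
      where
      open ≡-Reasoning
      B = profile ω

    phiCode-code : ∀ ω → ColumnSums ω → map (+_) (code ω) ≡ phiCode n ω
    phiCode-code ω sums = begin
      map (+_) (applyUpTo c (suc (suc N)))                 ≡⟨ cong (map (+_)) (applyUpTo-∷ʳ c (suc N)) ⟨
      map (+_) (applyUpTo c (suc N) ++ [ c (suc N) ])      ≡⟨ map-++ (+_) (applyUpTo c (suc N)) [ c (suc N) ] ⟩
      map (+_) (applyUpTo c (suc N)) ++ [ + c (suc N) ]    ≡⟨ cong₂ _++_ init (cong (λ k → [ + k ]) last) ⟩
      map F (map suc (upTo (suc N))) ++ [ + 0 ]          ∎
      where
      open ≡-Reasoning
      c = codeAt (profile ω)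
      F : ℕ → _
      F i = altSum (take i (ells ω)) - + (i / 2)
      entry : ∀ {p} → p < suc N → + c p ≡ F (suc p)
      entry {p} (s≤s p≤N) = begin
        + c p
          ≡⟨ cancel (c p) ⌊ suc p /2⌋ ⟨
        + (c p + ⌊ suc p /2⌋) - + ⌊ suc p /2⌋
          ≡⟨ cong₂ _-_ (altSum-ells ω sums p≤N) (cong +_ (sym (⌊n/2⌋≡n/2 (suc p)))) ⟨
        altSum (take (suc p) (ells ω)) - + (suc p / 2) ∎
        where
        cancel : ∀ a b → + (a + b) - + b ≡ + a
        cancel a b = trans (cong (_- + b) (ℤ.pos-+ a b)) (ℤ-cancel (+ a) (+ b))
          where
          ℤ-cancel : ∀ x y → x +ℤ y - y ≡ x
          ℤ-cancel = solve-∀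
      init : map (+_) (applyUpTo c (suc N)) ≡ map F (map suc (upTo (suc N)))
      init = begin
        map (+_) (applyUpTo c (suc N))    ≡⟨ map-applyUpTo c (+_) (suc N) ⟩
        applyUpTo (+_ ∘ c) (suc N)      ≡⟨ applyUpTo-cong (suc N) entry ⟩
        applyUpTo (F ∘ suc) (suc N)     ≡⟨ map-applyUpTo suc F (suc N) ⟨
        map F (applyUpTo suc (suc N))   ≡⟨ cong (map F) (map-upTo suc (suc N)) ⟨
        map F (map suc (upTo (suc N)))  ∎
      last : c (suc N) ≡ 0
      last = trans (cong₂ (codeEntry (parity (suc N))) (n∸n≡0 N) (H-beyond ω bot (n≤1+n N))) (codeEntry-zero (parity (suc N)))

  record LocalTwist (π : Parity) (q : ℕ) (ω ω′ : Cover N) : Set where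
    field
      horizontal : ∀ r → Moves π (H ω r q) (H ω′ r q)
      rung       : Moves (π ⁻¹) (W ω q) (W ω′ q)
      nextRung   : Moves (π ⁻¹) (W ω (suc q)) (W ω′ (suc q))
      H-fixed    : ∀ r {p} → p ≢ q → H ω′ r p ≡ H ω r p
      W-fixed    : ∀ {p} → p ≢ q → p ≢ suc q → W ω′ p ≡ W ω p

  faceIndex : Fin N → ℕ
  faceIndex f = toℕ (opposite f)

  face-colour : ∀ f → parity (toℕ f + N) ≡ parity (faceIndex f) ⁻¹
  face-colour f = begin
    parity (toℕ f + N)                       ≡⟨ cong (λ m → parity (toℕ f + m)) N≡ ⟨
    parity (toℕ f + (toℕ f + suc (faceIndex f))) ≡⟨ parity-double (toℕ f) (suc (faceIndex f)) ⟩
    parity (suc (faceIndex f))               ≡⟨ parity-suc (faceIndex f) ⟩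
    parity (faceIndex f) ⁻¹                  ∎
    where
    open ≡-Reasoning
    N≡ : toℕ f + suc (faceIndex f) ≡ N
    N≡ = trans (+-suc (toℕ f) _) (trans (cong (suc (toℕ f) +_) (opposite-prop f)) (m+[n∸m]≡n (toℕ<n f)))

  horizontal-direction : ∀ f → parity (toℕ f + N) ⁻¹ ≡ parity (faceIndex f)
  horizontal-direction f = trans (cong _⁻¹ (face-colour f)) (ℙ.⁻¹-involutive _)

  rung-direction : ∀ f → parity (suc (toℕ f + N)) ⁻¹ ≡ parity (faceIndex f) ⁻¹
  rung-direction f = trans (cong _⁻¹ (parity-suc (toℕ f + N))) (trans (ℙ.⁻¹-involutive _) (face-colour f))

  mult-vE-suc : ∀ ω f → mult ω (vE (Fin.suc f)) ≡ W ω (faceIndex f)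
  mult-vE-suc ω f = trans (mult-vE ω (Fin.suc f)) (cong (W ω) (opposite-suc f))

  mult-vE-inject₁ : ∀ ω f → mult ω (vE (inject₁ f)) ≡ W ω (suc (faceIndex f))
  mult-vE-inject₁ ω f = trans (mult-vE ω (inject₁ f)) (cong (W ω) (toℕ-opposite-inject₁ f))

  offFace⇒fixed : ∀ f {ω ω′} → (∀ e → ¬ OnFace f e → mult ω′ e ≡ mult ω e) →
                  (∀ r {p} → p ≢ faceIndex f → H ω′ r p ≡ H ω r p) ×
                  (∀ {p} → p ≢ faceIndex f → p ≢ suc (faceIndex f) → W ω′ p ≡ W ω p)
  offFace⇒fixed f {ω} {ω′} off = H-fixed , W-fixed
    where
    open ≡-Reasoning
    H-fixed : ∀ r {p} → p ≢ faceIndex f → H ω′ r p ≡ H ω r p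
    H-fixed r {p} p≢q with p <? N
    ... | no  p≮N = trans (H-beyond ω′ r (≮⇒≥ p≮N)) (sym (H-beyond ω r (≮⇒≥ p≮N)))
    ... | yes p<N = begin
      H ω′ r p
        ≡⟨ cong (H ω′ r) (toℕ-opposite-fromRight p<N) ⟨
      H ω′ r (toℕ (opposite j))
        ≡⟨ mult-hE ω′ r j ⟨
      mult ω′ (hE r j)
        ≡⟨ off (hE r j) (λ on → p≢q (trans (sym (toℕ-opposite-fromRight p<N)) (cong (toℕ ∘ opposite) (onFace-hE on)))) ⟩
      mult ω (hE r j)
        ≡⟨ mult-hE ω r j ⟩
      H ω r (toℕ (opposite j))
        ≡⟨ cong (H ω r) (toℕ-opposite-fromRight p<N) ⟩
      H ω r p ∎
      where j = fromRight p<N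
    W-fixed : ∀ {p} → p ≢ faceIndex f → p ≢ suc (faceIndex f) → W ω′ p ≡ W ω p
    W-fixed {p} p≢q p≢q+1 with p <? suc N
    ... | no  p≮N = trans (W-beyond ω′ (≮⇒≥ p≮N)) (sym (W-beyond ω (≮⇒≥ p≮N)))
    ... | yes p<N = begin
      W ω′ p                   ≡⟨ cong (W ω′) (toℕ-opposite-fromRight p<N) ⟨
      W ω′ (toℕ (opposite k))  ≡⟨ mult-vE ω′ k ⟨
      mult ω′ (vE k)           ≡⟨ off (vE k) (λ on → [ p≢q ∘ onSuc , p≢q+1 ∘ onInject₁ ]′ (onFace-vE on)) ⟩
      mult ω (vE k)            ≡⟨ mult-vE ω k ⟩
      W ω (toℕ (opposite k))   ≡⟨ cong (W ω) (toℕ-opposite-fromRight p<N) ⟩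
      W ω p                    ∎
      where
      k = fromRight p<N
      onSuc : k ≡ Fin.suc f → p ≡ faceIndex f
      onSuc k≡ = trans (sym (toℕ-opposite-fromRight p<N)) (trans (cong (toℕ ∘ opposite) k≡) (opposite-suc f))
      onInject₁ : k ≡ inject₁ f → p ≡ suc (faceIndex f)
      onInject₁ k≡ = trans (sym (toℕ-opposite-fromRight p<N)) (trans (cong (toℕ ∘ opposite) k≡) (toℕ-opposite-inject₁ f))

  fixed⇒offFace : ∀ f {ω ω′} → (∀ r {p} → p ≢ faceIndex f → H ω′ r p ≡ H ω r p) →
                  (∀ {p} → p ≢ faceIndex f → p ≢ suc (faceIndex f) → W ω′ p ≡ W ω p) →
                  ∀ e → ¬ OnFace f e → mult ω′ e ≡ mult ω e
  fixed⇒offFace f {ω} {ω′} H-fixed W-fixed (hE r j) off =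
    trans (mult-hE ω′ r j) (trans (H-fixed r j≢f) (sym (mult-hE ω r j)))
    where
    j≢f : toℕ (opposite j) ≢ faceIndex f
    j≢f eq = off (subst (λ i → OnFace f (hE r i)) (sym (toℕ-opposite-injective eq)) (hE-onFace r))
  fixed⇒offFace f {ω} {ω′} H-fixed W-fixed (vE k) off =
    trans (mult-vE ω′ k) (trans (W-fixed k≢suc k≢inject₁) (sym (mult-vE ω k)))
    where
    k≢suc : toℕ (opposite k) ≢ faceIndex f
    k≢suc eq = off (subst (OnFace f ∘ vE) (sym (toℕ-opposite-injective (trans eq (sym (opposite-suc f))))) vE-suc-onFace)
    k≢inject₁ : toℕ (opposite k) ≢ suc (faceIndex f)
    k≢inject₁ eq =
      off (subst (OnFace f ∘ vE) (sym (toℕ-opposite-injective (trans eq (sym (toℕ-opposite-inject₁ f))))) vE-inject₁-onFace)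

  twist⇒localTwist : ∀ f {ω ω′} → Twist f ω ω′ → LocalTwist (parity (faceIndex f)) (faceIndex f) ω ω′
  twist⇒localTwist f {ω} {ω′} twist = record
    { horizontal = horizontal
    ; rung       = moves-resp (rung-direction f) (mult-vE-suc ω f) (mult-vE-suc ω′ f) (twist⇒moves twist (there (here refl)))
    ; nextRung   = moves-resp (rung-direction f) (mult-vE-inject₁ ω f) (mult-vE-inject₁ ω′ f)
                     (twist⇒moves twist (there (there (there (here refl)))))
    ; H-fixed    = proj₁ fixed
    ; W-fixed    = proj₂ fixed
    }
    where
    fixed = offFace⇒fixed f (proj₂ (proj₂ (proj₂ twist)))
    horizontal : ∀ r → Moves (parity (faceIndex f)) (H ω r (faceIndex f)) (H ω′ r (faceIndex f))
    horizontal bot = moves-resp (horizontal-direction f) (mult-hE ω bot f) (mult-hE ω′ bot f) (twist⇒moves twist (here refl))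
    horizontal top = moves-resp (horizontal-direction f) (mult-hE ω top f) (mult-hE ω′ top f)
                       (twist⇒moves twist (there (there (here refl))))

  localTwist⇒twist : ∀ f {ω ω′} → LocalTwist (parity (faceIndex f)) (faceIndex f) ω ω′ → Twist f ω ω′
  localTwist⇒twist f {ω} {ω′} local = moves⇒twist moves (fixed⇒offFace f H-fixed W-fixed)
    where
    open LocalTwist local
    moves : ∀ {e r k} → (e , r , k) ∈ boundary f → Moves (colour N r k ⁻¹) (mult ω e) (mult ω′ e)
    moves (here refl) =
      moves-resp (sym (horizontal-direction f)) (sym (mult-hE ω bot f)) (sym (mult-hE ω′ bot f)) (horizontal bot)
    moves (there (here refl)) =
      moves-resp (sym (rung-direction f)) (sym (mult-vE-suc ω f)) (sym (mult-vE-suc ω′ f)) rung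
    moves (there (there (here refl))) =
      moves-resp (sym (horizontal-direction f)) (sym (mult-hE ω top f)) (sym (mult-hE ω′ top f)) (horizontal top)
    moves (there (there (there (here refl)))) =
      moves-resp (sym (rung-direction f)) (sym (mult-vE-inject₁ ω f)) (sym (mult-vE-inject₁ ω′ f)) nextRung

  module _ {π q ω ω′} (local : LocalTwist π q ω ω′) where
    open LocalTwist local

    prev-fixed : ∀ r {p} → p ≢ suc q → prev (H ω′ r) p ≡ prev (H ω r) p
    prev-fixed r {zero}  _     = refl
    prev-fixed r {suc p} p≢1+q = H-fixed r (p≢1+q ∘ cong suc)

    localTwist-columnSum : ∀ r p → columnSum ω′ r p ≡ columnSum ω r p
    localTwist-columnSum r p with p ≟ q | p ≟ suc q
    ... | yes refl | _ = begin
      W ω′ p + (H ω′ r p + prev (H ω′ r) p)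
        ≡⟨ cong (λ x → W ω′ p + (H ω′ r p + x)) (prev-fixed r (1+n≢n ∘ sym)) ⟩
      W ω′ p + (H ω′ r p + prev (H ω r) p)
        ≡⟨ moves-column π (prev (H ω r) p) (horizontal r) rung ⟩
      W ω p + (H ω r p + prev (H ω r) p) ∎
      where open ≡-Reasoning
    ... | no _ | yes refl = begin
      W ω′ (suc q) + (H ω′ r (suc q) + H ω′ r q)
        ≡⟨ cong (λ h → W ω′ (suc q) + (h + H ω′ r q)) (H-fixed r 1+n≢n) ⟩
      W ω′ (suc q) + (H ω r (suc q) + H ω′ r q)
        ≡⟨ moves-column′ π (H ω r (suc q)) (horizontal r) nextRung ⟩
      W ω (suc q) + (H ω r (suc q) + H ω r q) ∎
      where open ≡-Reasoning
    ... | no p≢q | no p≢1+q =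
      trans (cong₂ (λ w h → w + (h + prev (H ω′ r) p)) (W-fixed p≢q p≢1+q) (H-fixed r p≢q))
            (cong (λ x → W ω p + (H ω r p + x)) (prev-fixed r p≢1+q))

  localTwist-columnSums : ∀ {π q ω ω′} → LocalTwist π q ω ω′ → ColumnSums ω → ColumnSums ω′
  localTwist-columnSums local sums r q≤N = trans (localTwist-columnSum local r _) (sums r q≤N)

  _≼_ : Cover N → Cover N → Set
  ω ≼ ω′ = ∀ {p} → p < n → codeAt (profile ω) p ≤ codeAt (profile ω′) p

  Raises : (ℕ → ℕ) → (ℕ → ℕ) → ℕ → Set
  Raises g g′ q = codeAt g′ q ≡ suc (codeAt g q) × (∀ {p} → p ≢ q → g′ p ≡ g p)

  localTwist-raises : ∀ {q ω ω′} → ColumnSums ω → LocalTwist (parity q) q ω ω′ → Raises (profile ω) (profile ω′) q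
  localTwist-raises {q} {ω} sums local =
    moves-codeEntry (parity q) (admissible-≤-suc (profile-admissible ω sums) q) (horizontal bot) ,
    H-fixed bot
    where open LocalTwist local

  raises-≤ : ∀ {g g′ q} → Raises g g′ q → ∀ p → codeAt g p ≤ codeAt g′ p
  raises-≤ {q = q} (raised , fixed) p with p ≟ q
  ... | yes refl = ≤-trans (n≤1+n _) (≤-reflexive (sym raised))
  ... | no  p≢q  = ≤-reflexive (cong (codeEntry (parity p) (suc N ∸ p)) (sym (fixed p≢q)))

  raises-sum : ∀ {g g′ q} → q < n → Raises g g′ q → sum (codeOf g′) ≡ suc (sum (codeOf g))
  raises-sum {q = q} q<n (raised , fixed) =
    sum-applyUpTo-increment n q<n raised (λ {p} p≢q → cong (codeEntry (parity p) (suc N ∸ p)) (fixed p≢q))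

  steps⇒≼ : ∀ {k ω ω′} → ColumnSums ω → Steps k ω ω′ →
            ColumnSums ω′ × ω ≼ ω′ × sum (code ω′) ≡ k + sum (code ω)
  steps⇒≼ sums done = sums , (λ _ → ≤-refl) , refl
  steps⇒≼ {suc k} {ω} sums (step {_} {_} {ω₁} {_} (f , twist) rest) =
    sums′ , (λ {p} p<n → ≤-trans (raises-≤ raised p) (≼′ p<n)) ,
    trans sum≡ (trans (cong (k +_) (raises-sum (<N⇒<n (toℕ<n (opposite f))) raised))
                      (+-suc k _))
    where
    local = twist⇒localTwist f twist
    raised = localTwist-raises sums local
    ih = steps⇒≼ (localTwist-columnSums local sums) rest
    sums′ = proj₁ ih
    ≼′ = proj₁ (proj₂ ih)
    sum≡ = proj₂ (proj₂ ih)

  update : (ℕ → ℕ) → ℕ → ℕ → ℕ → ℕ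
  update g q v p with p ≟ q
  ... | yes _ = v
  ... | no  _ = g p

  update-same : ∀ g q v → update g q v q ≡ v
  update-same g q v with q ≟ q
  ... | yes _   = refl
  ... | no  q≢q = ⊥-elim (q≢q refl)

  update-other : ∀ g {q} v {p} → p ≢ q → update g q v p ≡ g p
  update-other g {q} v {p} p≢q with p ≟ q
  ... | yes p≡q = ⊥-elim (p≢q p≡q)
  ... | no  _   = refl

  prev-update : ∀ g {q} v {p} → p ≢ suc q → prev (update g q v) p ≡ prev g p
  prev-update g v {zero}  _     = refl
  prev-update g v {suc p} p≢1+q = update-other g v (p≢1+q ∘ cong suc)

  admissible-mono : ∀ {g g′} → Admissible g′ → (∀ p → g p ≤ g′ p) → Admissible g
  admissible-mono {g} {g′} (pairs , beyond) g≤g′ =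
    (λ {q} q<N → ≤-trans (+-mono-≤ (g≤g′ (suc q)) (g≤g′ q)) (pairs q<N)) ,
    (λ {q} N≤q → n≤0⇒n≡0 (subst (g q ≤_) (beyond N≤q) (g≤g′ q)))

  localTwist-update : ∀ {π q ω v} → ColumnSums ω → q < N → Moves π (profile ω q) v →
                      Admissible (update (profile ω) q v) → LocalTwist π q ω (fromProfile (update (profile ω) q v))
  localTwist-update {π} {q} {ω} {v} sums q<N move adm = record
    { horizontal = horizontal
    ; rung       = moves-resp refl (sym (W≡rungOf ω sums q≤N)) (sym (W-fromProfile g q≤N)) rung-moves
    ; nextRung   = moves-resp refl (sym (W≡rungOf ω sums q<N)) (sym (W-fromProfile g q<N)) nextRung-moves
    ; H-fixed    = H-fixed
    ; W-fixed    = W-fixed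
    }
    where
    B = profile ω
    g = update B q v
    q≤N = <⇒≤ q<N
    admB = profile-admissible ω sums
    horizontal : ∀ r → Moves π (H ω r q) (H (fromProfile g) r q)
    horizontal r =
      moves-resp refl (sym (H≡profile ω sums r q)) (sym (trans (H-fromProfile adm r q) (update-same B q v))) move
    rung-moves : Moves (π ⁻¹) (rungOf B q) (rungOf g q)
    rung-moves = moves-∸ π (admissible-prev admB q≤N) (admissible-prev adm q≤N)
      (moves-resp refl refl (cong₂ _+_ (sym (update-same B q v)) (sym (prev-update B {q} v (1+n≢n ∘ sym))))
                  (moves-+ˡ π (prev B q) move))
    nextRung-moves : Moves (π ⁻¹) (rungOf B (suc q)) (rungOf g (suc q))
    nextRung-moves = moves-∸ π (admissible-prev admB q<N) (admissible-prev adm q<N)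
      (moves-resp refl refl (cong₂ _+_ (sym (update-other B v 1+n≢n)) (sym (update-same B q v)))
                  (moves-+ʳ π (B (suc q)) move))
    H-fixed : ∀ r {p} → p ≢ q → H (fromProfile g) r p ≡ H ω r p
    H-fixed r {p} p≢q = trans (H-fromProfile adm r p) (trans (update-other B v p≢q) (sym (H≡profile ω sums r p)))
    W-fixed : ∀ {p} → p ≢ q → p ≢ suc q → W (fromProfile g) p ≡ W ω p
    W-fixed {p} p≢q p≢1+q with p ≤? N
    ... | yes p≤N = trans (W-fromProfile g p≤N)
                      (trans (cong (λ s → suc (N ∸ p) ∸ s) (cong₂ _+_ (update-other B v p≢q) (prev-update B v p≢1+q)))
                             (sym (W≡rungOf ω sums p≤N)))
    ... | no  p≰N = trans (W-beyond (fromProfile g) (≰⇒> p≰N)) (sym (W-beyond ω (≰⇒> p≰N)))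

  codeAt-parity : ∀ {π} g p → parity p ≡ π → codeAt g p ≡ codeEntry π (suc N ∸ p) (g p)
  codeAt-parity g p refl = refl

  Short : Cover N → Cover N → ℕ → Set
  Short ω ω′ q = codeAt (profile ω) q < codeAt (profile ω′) q

  lower-even : ∀ ω ω′ → ColumnSums ω → ColumnSums ω′ → ∀ {q} → q < N → parity q ≡ 0ℙ → Short ω ω′ q →
               Σ[ ω″ ∈ Cover N ] LocalTwist (parity q) q ω ω″
  lower-even ω ω′ sums sums′ {q} q<N even short = fromProfile lowered , localTwist-update sums q<N move adm
    where
    B = profile ω
    positive : B q ≢ 0
    positive Bq≡0 = <⇒≱ short (begin
      codeAt (profile ω′) q   ≤⟨ codeAt-≤ (profile-admissible ω′ sums′) q ⟩
      suc N ∸ q               ≡⟨ trans (cong (λ b → suc N ∸ q ∸ b) (sym Bq≡0)) (sym (codeAt-parity B q even)) ⟩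
      codeAt B q              ∎)
      where open ≤-Reasoning
    lowered = update B q (pred (B q))
    move : Moves (parity q) (B q) (pred (B q))
    move = subst (λ π → Moves π (B q) (pred (B q))) (sym even) (sym (suc-pred (B q) {{≢-nonZero positive}}))
    adm : Admissible lowered
    adm = admissible-mono (profile-admissible ω sums) below
      where
      below : ∀ p → lowered p ≤ B p
      below p with p ≟ q
      ... | yes refl = pred[n]≤n
      ... | no  _    = ≤-refl

  -- Odd code entries are the profile values themselves; equal even entries force equal profile values.
  profile-≤ : ∀ ω ω′ → ColumnSums ω → ColumnSums ω′ → ω ≼ ω′ →
              (∀ {p} → p < N → parity p ≡ 0ℙ → ¬ Short ω ω′ p) → ∀ p → profile ω p ≤ profile ω′ p
  profile-≤ ω ω′ sums sums′ ω≼ω′ even-fine p with p <? N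
  ... | no  p≮N = subst (_≤ profile ω′ p) (sym (H-beyond ω bot (≮⇒≥ p≮N))) z≤n
  ... | yes p<N with 0ℙ-or-1ℙ (parity p)
  ...   | inj₁ even = ≤-reflexive (codeEntry-injective 0ℙ (admissible-≤-suc (profile-admissible ω sums) p)
                                                          (admissible-≤-suc (profile-admissible ω′ sums′) p)
                                    (trans (sym (codeAt-parity (profile ω) p even)) (trans same (codeAt-parity (profile ω′) p even))))
    where
    same : codeAt (profile ω) p ≡ codeAt (profile ω′) p
    same = ≤-antisym (ω≼ω′ (<N⇒<n p<N)) (≮⇒≥ (even-fine p<N even))
  ...   | inj₂ odd = subst₂ _≤_ (codeAt-parity (profile ω) p odd) (codeAt-parity (profile ω′) p odd) (ω≼ω′ (<N⇒<n p<N))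

  raise-odd : ∀ ω ω′ → ColumnSums ω → ColumnSums ω′ → ω ≼ ω′ →
              (∀ {p} → p < N → parity p ≡ 0ℙ → ¬ Short ω ω′ p) → ∀ {q} → q < N → Short ω ω′ q →
              Σ[ ω″ ∈ Cover N ] LocalTwist (parity q) q ω ω″
  raise-odd ω ω′ sums sums′ ω≼ω′ even-fine {q} q<N short = fromProfile raised , localTwist-update sums q<N move adm
    where
    B = profile ω
    odd : parity q ≡ 1ℙ
    odd = [ (λ even → ⊥-elim (even-fine q<N even short)) , id ]′ (0ℙ-or-1ℙ (parity q))
    raised = update B q (suc (B q))
    move : Moves (parity q) (B q) (suc (B q))
    move = subst (λ π → Moves π (B q) (suc (B q))) (sym odd) refl
    adm : Admissible raised
    adm = admissible-mono (profile-admissible ω′ sums′) below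
      where
      below : ∀ p → raised p ≤ profile ω′ p
      below p with p ≟ q
      ... | yes refl = subst₂ _<_ (codeAt-parity B p odd) (codeAt-parity (profile ω′) p odd) short
      ... | no  _    = profile-≤ ω ω′ sums sums′ ω≼ω′ even-fine p

  -- If some entry falls short, a twist moves ω towards ω′: lower the profile at a short even
  -- position if there is one, otherwise raise it at the given (necessarily odd) one.
  twist-towards : ∀ ω ω′ → ColumnSums ω → ColumnSums ω′ → ω ≼ ω′ → ∀ {p} → p < N → Short ω ω′ p →
                  Σ[ q ∈ ℕ ] q < N × Short ω ω′ q × Σ[ ω″ ∈ Cover N ] LocalTwist (parity q) q ω ω″
  twist-towards ω ω′ sums sums′ ω≼ω′ {p} p<N short
    with anyUpTo? (λ q → (parity q ℙ.≟ 0ℙ) ×-dec (codeAt (profile ω) q <? codeAt (profile ω′) q)) N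
  ... | yes (q , q<N , even , q-short) = q , q<N , q-short , lower-even ω ω′ sums sums′ q<N even q-short
  ... | no  no-even                    = p , p<N , short , raise-odd ω ω′ sums sums′ ω≼ω′ even-fine p<N short
    where
    even-fine : ∀ {q} → q < N → parity q ≡ 0ℙ → ¬ Short ω ω′ q
    even-fine q<N even q-short = no-even (_ , q<N , even , q-short)

  ≼⇒steps : ∀ d ω ω′ → ColumnSums ω → ColumnSums ω′ → ω ≼ ω′ →
            sum (code ω′) ≡ d + sum (code ω) → Steps d ω ω′
  ≼⇒steps zero ω ω′ sums sums′ ω≼ω′ sum≡ =
    subst (Steps 0 ω) (code-injective ω ω′ sums sums′ λ p<N → sum-applyUpTo-≤-≡ n ω≼ω′ (sym sum≡) (<N⇒<n p<N))
          done
  ≼⇒steps (suc d) ω ω′ sums sums′ ω≼ω′ sum≡ with anyUpTo? (λ p → codeAt (profile ω) p <? codeAt (profile ω′) p) N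
  ... | no none = ⊥-elim (m≢1+n+m (sum (code ω)) {d} (trans (sym (cong sum (applyUpTo-cong n equal))) sum≡))
    where
    equal : ∀ {p} → p < n → codeAt (profile ω′) p ≡ codeAt (profile ω) p
    equal {p} p<n with p <? N
    ... | yes p<N = ≤-antisym (≮⇒≥ (λ short → none (p , p<N , short))) (ω≼ω′ p<n)
    ... | no  p≮N = cong (codeEntry (parity p) (suc N ∸ p))
                         (trans (H-beyond ω′ bot (≮⇒≥ p≮N)) (sym (H-beyond ω bot (≮⇒≥ p≮N))))
  ... | yes (p , p<N , p-short) with twist-towards ω ω′ sums sums′ ω≼ω′ p<N p-short
  ...   | q , q<N , q-short , ω″ , local =
    step (fromRight q<N , localTwist⇒twist (fromRight q<N) local′)
         (≼⇒steps d ω″ ω′ (localTwist-columnSums local sums) sums′ ω″≼ω′ sum≡′)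
    where
    local′ = subst (λ i → LocalTwist (parity i) i ω ω″) (sym (toℕ-opposite-fromRight q<N)) local
    raised = localTwist-raises sums local
    ω″≼ω′ : ω″ ≼ ω′
    ω″≼ω′ {p} p<n with p ≟ q
    ... | yes refl = subst (_≤ codeAt (profile ω′) p) (sym (proj₁ raised)) q-short
    ... | no  p≢q  =
      subst (_≤ codeAt (profile ω′) p) (cong (codeEntry (parity p) (suc N ∸ p)) (sym (proj₂ raised p≢q))) (ω≼ω′ p<n)
    sum≡′ : sum (code ω′) ≡ d + sum (code ω″)
    sum≡′ = trans sum≡ (trans (sym (+-suc d _)) (cong (d +_) (sym (raises-sum (<N⇒<n q<N) raised))))

  ≤F⇔≼ : ∀ ω ω′ → ColumnSums ω → ColumnSums ω′ → ω ≤F ω′ ⇔ ω ≼ ω′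
  ≤F⇔≼ ω ω′ sums sums′ = mk⇔ to′ from′
    where
    to′ : ω ≤F ω′ → ω ≼ ω′
    to′ (_ , steps) = proj₁ (proj₂ (steps⇒≼ sums steps))
    from′ : ω ≼ ω′ → ω ≤F ω′
    from′ ω≼ω′ = sum (code ω′) ∸ sum (code ω) ,
                 ≼⇒steps _ ω ω′ sums sums′ ω≼ω′ (sym (m∸n+n≡m (sum-applyUpTo-mono n ω≼ω′)))

  ≤LM⇔≼ : ∀ ω ω′ → ColumnSums ω → ColumnSums ω′ → φ ω ≤LM φ ω′ ⇔ ω ≼ ω′
  ≤LM⇔≼ ω ω′ sums sums′ =
    subst₂ (λ L L′ → Pointwise _≤_ L L′ ⇔ ω ≼ ω′) (sym (lehmer-φ ω sums)) (sym (lehmer-φ ω′ sums′))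
           (pointwise-applyUpTo n)

  minProfile : ℕ → ℕ
  minProfile q = codeEntry (parity q) (N ∸ q) 0

  minProfile-admissible : Admissible minProfile
  minProfile-admissible = pairs , beyond
    where
    pair : ∀ π m → codeEntry (π ⁻¹) m 0 + codeEntry π (suc m) 0 ≤ suc m
    pair 0ℙ m = ≤-refl
    pair 1ℙ m = ≤-trans (≤-reflexive (+-identityʳ m)) (n≤1+n m)
    pairs : ∀ {q} → q < N → minProfile (suc q) + minProfile q ≤ N ∸ q
    pairs {q} q<N = subst₂ (λ π m → codeEntry π (N ∸ suc q) 0 + codeEntry (parity q) m 0 ≤ m)
                           (sym (parity-suc q)) (sym (∸-suc q<N)) (pair (parity q) (N ∸ suc q))
    beyond : ∀ {q} → N ≤ q → minProfile q ≡ 0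
    beyond {q} N≤q = trans (cong (λ m → codeEntry (parity q) m 0) (m≤n⇒m∸n≡0 N≤q)) (codeEntry-zero (parity q))

  ω₀ : Cover N
  ω₀ = fromProfile minProfile

  ω₀-columnSums : ColumnSums ω₀
  ω₀-columnSums = fromProfile-columnSums minProfile-admissible

  codeAt-ω₀ : ∀ p → codeAt (profile ω₀) p ≡ codeAt minProfile p
  codeAt-ω₀ p = cong (codeEntry (parity p) (suc N ∸ p)) (H-fromProfile minProfile-admissible bot p)

  ω₀≼ : ∀ ω → ColumnSums ω → ω₀ ≼ ω
  ω₀≼ ω sums {p} _ = subst (_≤ codeAt (profile ω) p) (sym (codeAt-ω₀ p))
                           (codeEntry-min (parity p) (admissible-≤ (profile-admissible ω sums) p))

  sum-code-ω₀ : sum (code ω₀) ≡ ⌊ n /2⌋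
  sum-code-ω₀ = begin
    sum (applyUpTo (codeAt (profile ω₀)) n)
      ≡⟨ cong sum (applyUpTo-cong n (λ {p} _ → codeAt-ω₀ p)) ⟩
    sum (applyUpTo c₀ n)
      ≡⟨ cong sum (applyUpTo-∷ʳ c₀ (suc N)) ⟨
    sum (applyUpTo c₀ (suc N) ++ [ c₀ (suc N) ])
      ≡⟨ sum-++ (applyUpTo c₀ (suc N)) _ ⟩
    sum (applyUpTo c₀ (suc N)) + (c₀ (suc N) + 0)
      ≡⟨ cong₂ _+_ (cong sum (applyUpTo-cong (suc N) (λ {p} p<1+N → evenBit≡ p (≤-pred p<1+N)))) (cong (_+ 0) last) ⟩
    sum (applyUpTo (evenBit ∘ parity) (suc N)) + 0
      ≡⟨ +-identityʳ _ ⟩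
    sum (applyUpTo (evenBit ∘ parity) (suc N))
      ≡⟨ sum-evenBits (suc N) ⟩
    ⌊ n /2⌋ ∎
    where
    open ≡-Reasoning
    c₀ = codeAt minProfile
    minimal-entry : ∀ π m → codeEntry π (suc m) (codeEntry π m 0) ≡ evenBit π
    minimal-entry 0ℙ m = m+n∸n≡m 1 m
    minimal-entry 1ℙ m = refl
    evenBit≡ : ∀ p → p ≤ N → c₀ p ≡ evenBit (parity p)
    evenBit≡ p p≤N =
      trans (cong (λ m → codeEntry (parity p) m (minProfile p)) (+-∸-assoc 1 p≤N)) (minimal-entry (parity p) (N ∸ p))
    last : c₀ (suc N) ≡ 0
    last = trans (cong₂ (codeEntry (parity (suc N))) (n∸n≡0 N) (proj₂ minProfile-admissible (n≤1+n N)))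
                 (codeEntry-zero (parity (suc N)))

  rank : Cover N → ℕ
  rank ω = sum (code ω) ∸ ⌊ n /2⌋

  ⌊n/2⌋≤sum-code : ∀ ω → ColumnSums ω → ⌊ n /2⌋ ≤ sum (code ω)
  ⌊n/2⌋≤sum-code ω sums = subst (_≤ sum (code ω)) sum-code-ω₀ (sum-applyUpTo-mono n (ω₀≼ ω sums))

  steps-rank : ∀ ω → ColumnSums ω → Steps (rank ω) ω₀ ω
  steps-rank ω sums = ≼⇒steps (rank ω) ω₀ ω ω₀-columnSums sums (ω₀≼ ω sums)
    (sym (trans (cong (rank ω +_) sum-code-ω₀) (m∸n+n≡m (⌊n/2⌋≤sum-code ω sums))))

  steps-length : ∀ {k} ω → Steps k ω₀ ω → rank ω ≡ k
  steps-length {k} ω steps =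
    trans (cong (_∸ ⌊ n /2⌋) (trans (proj₂ (proj₂ (steps⇒≼ ω₀-columnSums steps))) (cong (k +_) sum-code-ω₀)))
          (m+n∸n≡m k ⌊ n /2⌋)

  inv-φ : ∀ ω → ColumnSums ω → inv (φ ω) ≡ ⌊ n /2⌋ + rank ω
  inv-φ ω sums = begin
    inv (φ ω)                      ≡⟨ inv≡sum∘lehmer (φ ω) ⟩
    sum (lehmer (φ ω))             ≡⟨ cong sum (lehmer-φ ω sums) ⟩
    sum (code ω)                   ≡⟨ m+[n∸m]≡n (⌊n/2⌋≤sum-code ω sums) ⟨
    ⌊ n /2⌋ + rank ω               ∎
    where open ≡-Reasoning

  altPerms↭φ-covers : altPerms n ↭ map φ (coverList N)
  altPerms↭φ-covers = ∼bag⇒↭ (unique∧set⇒bag (altPerms-unique n) φ-covers-unique (mk⇔ to′ from′))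
    where
    φ-covers-unique : Unique (map φ (coverList N))
    φ-covers-unique = unique-map⁺ IsCover φ
      (λ {ω} {ω′} isCover isCover′ → φ-injective ω ω′ (columnSums ω isCover) (columnSums ω′ isCover′))
                                  (All.all-filter isCover? coverCandidates) coverList-unique
    to′ : ∀ {σ} → σ ∈ altPerms n → σ ∈ map φ (coverList N)
    to′ {σ} σ∈ with φ-surjective σ (proj₁ (to (∈-altPerms n σ) σ∈)) (proj₂ (to (∈-altPerms n σ) σ∈))
    ... | ω , isCover , refl = ∈-map⁺ φ (∈-coverList ω isCover)
    from′ : ∀ {σ} → σ ∈ map φ (coverList N) → σ ∈ altPerms n
    from′ σ∈ with ∈-map⁻ φ σ∈
    ... | ω , ω∈ , refl = from (∈-altPerms n (φ ω)) (φ-isPerm ω sums , φ-alternating ω sums)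
      where sums = columnSums ω (proj₂ (∈-filter⁻ isCover? {xs = coverCandidates} ω∈))

  Eₙ-identity : ∀ q → sum (map (λ σ → q ^ inv σ) (altPerms n)) ≡
                      q ^ (n / 2) * sum (map (λ ω → q ^ rank ω) (coverList N))
  Eₙ-identity q = begin
    sum (map (λ σ → q ^ inv σ) (altPerms n))
      ≡⟨ sum-↭ (Perm.map⁺ (λ σ → q ^ inv σ) altPerms↭φ-covers) ⟩
    sum (map (λ σ → q ^ inv σ) (map φ (coverList N)))
      ≡⟨ cong sum (map-∘ (coverList N)) ⟨
    sum (map (λ ω → q ^ inv (φ ω)) (coverList N))
      ≡⟨ sum-map-cong (All.map (weight _) (All.all-filter isCover? coverCandidates)) ⟩
    sum (map (λ ω → q ^ (n / 2) * q ^ rank ω) (coverList N))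
      ≡⟨ sum-map-*ˡ (q ^ (n / 2)) (λ ω → q ^ rank ω) (coverList N) ⟩
    q ^ (n / 2) * sum (map (λ ω → q ^ rank ω) (coverList N)) ∎
    where
    open ≡-Reasoning
    weight : ∀ ω → IsCover ω → q ^ inv (φ ω) ≡ q ^ (n / 2) * q ^ rank ω
    weight ω isCover = begin
      q ^ inv (φ ω)               ≡⟨ cong (q ^_) (inv-φ ω (columnSums ω isCover)) ⟩
      q ^ (⌊ n /2⌋ + rank ω)      ≡⟨ ^-distribˡ-+-* q ⌊ n /2⌋ (rank ω) ⟩
      q ^ ⌊ n /2⌋ * q ^ rank ω    ≡⟨ cong (λ e → q ^ e * q ^ rank ω) (⌊n/2⌋≡n/2 n) ⟩
      q ^ (n / 2) * q ^ rank ω    ∎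

open import Data.Integer using (+_)

theorem9 : (n : ℕ) → 2 ≤ n →
    -- (a) φ(ω) is the permutation with Lehmer code phiCode n ω, and φ is a
    --     poset isomorphism (Ω(G^s_{n-2}), face twist order) ≅ (Alt_n, left middle order)
    (Σ[ φ ∈ (Cover (n ∸ 2) → List ℕ) ]
        (∀ ω → IsCover ω → IsPerm n (φ ω) × map (+_) (lehmer (φ ω)) ≡ phiCode n ω)
      × (∀ ω → IsCover ω → Alternating (φ ω))
      × (∀ ω ω' → IsCover ω → IsCover ω' → φ ω ≡ φ ω' → ω ≡ ω')
      × (∀ σ → IsPerm n σ → Alternating σ → Σ[ ω ∈ Cover (n ∸ 2) ] (IsCover ω × φ ω ≡ σ))
      × (∀ ω ω' → IsCover ω → IsCover ω' → (ω ≤F ω' ⇔ φ ω ≤LM φ ω')))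
    ×
    -- (b) with ω₀ the minimal element and rk the rank function,
    --     E_n(q) = q^{⌊n/2⌋} Ω(G^s_{n-2}, q)
    (Σ[ ω₀ ∈ Cover (n ∸ 2) ] IsCover ω₀ × (∀ ω → IsCover ω → ω₀ ≤F ω) ×
      Σ[ rk ∈ (Cover (n ∸ 2) → ℕ) ]
          (∀ ω → IsCover ω → Steps (rk ω) ω₀ ω × (∀ k → Steps k ω₀ ω → rk ω ≤ k))
        × (∀ (q : ℕ) → sum (map (λ σ → q ^ inv σ) (altPerms n))
                       ≡ q ^ (n / 2) * sum (map (λ ω → q ^ rk ω) (coverList (n ∸ 2)))))
theorem9 (suc (suc N)) (s≤s (s≤s z≤n)) =
  ( φ
  , (λ ω isCover → φ-isPerm ω (columnSums ω isCover) ,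
                   trans (cong (map (+_)) (lehmer-φ ω (columnSums ω isCover))) (phiCode-code ω (columnSums ω isCover)))
  , (λ ω isCover → φ-alternating ω (columnSums ω isCover))
  , (λ ω ω′ isCover isCover′ → φ-injective ω ω′ (columnSums ω isCover) (columnSums ω′ isCover′))
  , φ-surjective
  , (λ ω ω′ isCover isCover′ → ⇔-sym (≤LM⇔≼ ω ω′ (columnSums ω isCover) (columnSums ω′ isCover′))
                                ⇔-∘ ≤F⇔≼ ω ω′ (columnSums ω isCover) (columnSums ω′ isCover′))
  ) ,
  ( ω₀ , from (isCover⇔columnSums ω₀) ω₀-columnSums
  , (λ ω isCover → rank ω , steps-rank ω (columnSums ω isCover))
  , rank
  , (λ ω isCover → steps-rank ω (columnSums ω isCover) , λ k steps → ≤-reflexive (steps-length ω steps))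
  , Eₙ-identity
  )
  where open Ladder N
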